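{- Define the stable set formulation $R^{(B)}$ by $R^{(B)}(G) = R_{\mathrm{edge}}(G)$ if $G$ is the complete graph $K_3$, and $R^{(B)}(G) = P_{\mathrm{stab}}(G)$ otherwise. Then $R^{(B)}$ satisfies Conditions (A) and (C), violates Condition (B), and $R^{(B)}(G)$ has the persistency property for every finite simple graph $G$.
   Context: $\mathcal{G}$ is the set of finite undirected simple graphs. For $G \in \mathcal{G}$, $P_{\mathrm{stab}}(G)$ is the convex hull of characteristic vectors of stable sets of $G$ and $R_{\mathrm{edge}}(G) = \{x \in [0,1]^{V(G)} : x_v + x_w \le 1 \text{ for each edge } \{v,w\} \in E(G)\}$. A stable set formulation is a map $R$ assigning to every $G \in \mathcal{G}$ a polytope $R(G) \subseteq \mathbb{R}^{V(G)}$ with $R(G) \cap \mathbb{Z}^{V(G)} = P_{\mathrm{stab}}(G) \cap \mathbb{Z}^{V(G)}$. For $U \subseteq V(G)$, $G[U]$ is the induced subgraph; an inequality with support $U$ is regarded as an inequality on $\mathbb{R}^U$ for polytopes of $G[U]$. Condition (A): for each $G$, each inequality with support $U$ that is facet-defining for $R(G)$ is also facet-defining for $P_{\mathrm{stab}}(G[U])$. Condition (B): for each $G$, each inequality with support $U$ that is facet-defining for $R(G)$ is valid for $R(G[U])$. The 1-sum $G_1 \oplus^{v_1}_{v_2} G_2$ is the disjoint union of $G_1, G_2$ with $v_1 \in V(G_1)$ and $v_2 \in V(G_2)$ identified; for polytopes $P \subseteq \mathbb{R}^m$, $Q \subseteq \mathbb{R}^n$, $P \oplus^i_j Q$ is the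 projection of $\mathrm{conv}(\{(x,y) \in P \times Q : x_i = y_j\})$ onto all variables except $y_j$. Condition (C): $R(G_1 \oplus^{v_1}_{v_2} G_2) \subseteq R(G_1) \oplus^{v_1}_{v_2} R(G_2)$ for all $G_1, G_2, v_1, v_2$. A polytope $P \subseteq [0,1]^n$ has the persistency property if for every $c \in \mathbb{R}^n$ and every $c$-maximal point $x \in P$ there is a $c$-maximal $y \in P \cap \{0,1\}^n$ (maximal among integer points of $P$) with $y_i = x_i$ whenever $x_i \in \{0,1\}$.
   Formalization: Polytopes, points, facet-defining inequalities, objectives c and c-maximal points x are taken over ℚ instead of ℝ. -}

module Defs where

open import Data.Nat using (ℕ; zero; suc; _+_)
open import Data.Fin using (Fin; zero; suc; splitAt; _↑ˡ_; _↑ʳ_; punchIn; _≟_)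
open import Data.Fin.Subset using (Subset; Side; inside; outside; _∈_)
open import Data.Vec using (Vec; []; _∷_; tabulate; lookup)
open import Data.Bool using (Bool; true; false; _∨_; if_then_else_)
open import Data.Maybe using (Maybe; just; nothing)
open import Data.Sum using (_⊎_; inj₁; inj₂)
open import Data.Product using (Σ; ∃; _×_; _,_)
open import Data.Rational using (ℚ; 0ℚ; 1ℚ; _≤_)
  renaming (_+_ to _+ℚ_; _*_ to _*ℚ_; _≟_ to _≟ℚ_)
open import Relation.Nullary using (¬_; yes; no)
open import Relation.Binary.PropositionalEquality using (_≡_; _≢_; refl; trans; sym)

record Graph (n : ℕ) : Set where
  field
    adj   : Fin n → Fin n → Bool
    adj-sym : ∀ u v → adj u v ≡ adj v u
    adj-irr : ∀ v → adj v v ≡ false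
open Graph public

Edge : ∀ {n} → Graph n → Fin n → Fin n → Set
Edge G u v = adj G u v ≡ true

Point : ℕ → Set
Point n = Fin n → ℚ

Poly : ℕ → Set₁
Poly n = Point n → Set

sumFin : ∀ {k} → (Fin k → ℚ) → ℚ
sumFin {zero}  f = 0ℚ
sumFin {suc k} f = f zero +ℚ sumFin (λ i → f (suc i))

dot : ∀ {n} → Point n → Point n → ℚ
dot a x = sumFin (λ i → a i *ℚ x i)

Conv : ∀ {n} → Poly n → Poly n
Conv {n} S x =
  Σ ℕ λ k → Σ (Fin k → Point n) λ p → Σ (Fin k → ℚ) λ μ →
    (∀ i → S (p i)) × (∀ i → 0ℚ ≤ μ i) × (sumFin μ ≡ 1ℚ) ×
    (∀ j → x j ≡ sumFin (λ i → μ i *ℚ p i j))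

chi : ∀ {n} → Subset n → Point n
chi S v with lookup S v
... | inside  = 1ℚ
... | outside = 0ℚ

IsStable : ∀ {n} → Graph n → Subset n → Set
IsStable G S = ∀ u v → u ∈ S → v ∈ S → adj G u v ≡ false

Pstab : ∀ {n} → Graph n → Poly n
Pstab G = Conv (λ x → Σ _ λ S → IsStable G S × (∀ j → x j ≡ chi S j))

Redge : ∀ {n} → Graph n → Poly n
Redge G x = (∀ v → (0ℚ ≤ x v) × (x v ≤ 1ℚ)) ×
            (∀ v w → Edge G v w → x v +ℚ x w ≤ 1ℚ)

AffIndep : ∀ {n k} → (Fin k → Point n) → Set
AffIndep {n} {k} p = ∀ (μ : Fin k → ℚ) → sumFin μ ≡ 0ℚ →
  (∀ j → sumFin (λ i → μ i *ℚ p i j) ≡ 0ℚ) → ∀ i → μ i ≡ 0ℚ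

-- P contains k affinely independent points (i.e. dim P ≥ k - 1)
HasAffIndep : ∀ {n} → Poly n → ℕ → Set
HasAffIndep {n} P k = Σ (Fin k → Point n) λ p → (∀ i → P (p i)) × AffIndep p

Valid : ∀ {n} → Poly n → Point n → ℚ → Set
Valid P a b = ∀ x → P x → dot a x ≤ b

Face : ∀ {n} → Poly n → Point n → ℚ → Poly n
Face P a b x = P x × (dot a x ≡ b)

-- a·x ≤ b is facet-defining for P: valid, and the face it defines has
-- dimension dim P - 1 (here dim P = d+1, dim face = d).
FacetDefining : ∀ {n} → Poly n → Point n → ℚ → Set
FacetDefining P a b = Valid P a b × Σ ℕ λ d →
  HasAffIndep P (2 + d) × ¬ HasAffIndep P (3 + d) ×
  HasAffIndep (Face P a b) (1 + d) × ¬ HasAffIndep (Face P a b) (2 + d)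

card : ∀ {n} → Subset n → ℕ
card []            = 0
card (inside ∷ U)  = suc (card U)
card (outside ∷ U) = card U

emb : ∀ {n} (U : Subset n) → Fin (card U) → Fin n
emb (inside ∷ U)  zero    = zero
emb (inside ∷ U)  (suc i) = suc (emb U i)
emb (outside ∷ U) i       = suc (emb U i)

induced : ∀ {n} → Graph n → (U : Subset n) → Graph (card U)
induced G U = record
  { adj = λ i j → adj G (emb U i) (emb U j)
  ; adj-sym = λ i j → adj-sym G (emb U i) (emb U j)
  ; adj-irr = λ i → adj-irr G (emb U i) }

side : ℚ → Side
side q with q ≟ℚ 0ℚ
... | yes _ = outside
... | no  _ = inside

supp : ∀ {n} → Point n → Subset n
supp a = tabulate (λ v → side (a v))

restrict : ∀ {n} → (a : Point n) → Point (card (supp a))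
restrict a i = a (emb (supp a) i)

Formulation : Set₁
Formulation = ∀ {n} → Graph n → Poly n

CondA : Formulation → Set
CondA R = ∀ {n} (G : Graph n) (a : Point n) (b : ℚ) →
  FacetDefining (R G) a b →
  FacetDefining (Pstab (induced G (supp a))) (restrict a) b

CondB : Formulation → Set
CondB R = ∀ {n} (G : Graph n) (a : Point n) (b : ℚ) →
  FacetDefining (R G) a b →
  Valid (R (induced G (supp a))) (restrict a) b

-- G₁ has vertices Fin n₁, G₂ has vertices Fin (suc m₂); the
-- 1-sum has vertices Fin (n₁ + m₂): the first n₁ are those of G₁ (v₁ being
-- the identified vertex), the remaining m₂ are the vertices of G₂ other
-- than v₂, in order (punchIn v₂).

adjM : ∀ {n} → Graph n → Maybe (Fin n) → Maybe (Fin n) → Bool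
adjM G (just u) (just v) = adj G u v
adjM G _        _        = false

adjM-sym : ∀ {n} (G : Graph n) x y → adjM G x y ≡ adjM G y x
adjM-sym G (just u) (just v) = adj-sym G u v
adjM-sym G (just u) nothing  = refl
adjM-sym G nothing  (just v) = refl
adjM-sym G nothing  nothing  = refl

adjM-irr : ∀ {n} (G : Graph n) x → adjM G x x ≡ false
adjM-irr G (just u) = adj-irr G u
adjM-irr G nothing  = refl

toG₁ : ∀ {n₁ m₂} → Fin (n₁ + m₂) → Maybe (Fin n₁)
toG₁ {n₁} k with splitAt n₁ k
... | inj₁ u = just u
... | inj₂ _ = nothing

toG₂ : ∀ {n₁ m₂} → Fin n₁ → Fin (suc m₂) → Fin (n₁ + m₂) → Maybe (Fin (suc m₂))
toG₂ {n₁} v₁ v₂ k with splitAt n₁ k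
... | inj₁ u with u ≟ v₁
...   | yes _ = just v₂
...   | no  _ = nothing
toG₂ {n₁} v₁ v₂ k | inj₂ t = just (punchIn v₂ t)

∨-false : ∀ {a b} → a ≡ false → b ≡ false → (a ∨ b) ≡ false
∨-false {false} {false} refl refl = refl

oneSum : ∀ {n₁ m₂} → Graph n₁ → Graph (suc m₂) → Fin n₁ → Fin (suc m₂) →
         Graph (n₁ + m₂)
oneSum {n₁} {m₂} G₁ G₂ v₁ v₂ = record
  { adj = λ x y → adjM G₁ (toG₁ {n₁} {m₂} x) (toG₁ {n₁} {m₂} y)
                ∨ adjM G₂ (toG₂ v₁ v₂ x) (toG₂ v₁ v₂ y)
  ; adj-sym = λ x y → cong2∨ (adjM-sym G₁ (toG₁ {n₁} {m₂} x) (toG₁ {n₁} {m₂} y))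
                             (adjM-sym G₂ (toG₂ v₁ v₂ x) (toG₂ v₁ v₂ y))
  ; adj-irr = λ x → ∨-false (adjM-irr G₁ (toG₁ {n₁} {m₂} x))
                            (adjM-irr G₂ (toG₂ v₁ v₂ x)) }
  where
  cong2∨ : ∀ {a b c d : Bool} → a ≡ c → b ≡ d → (a ∨ b) ≡ (c ∨ d)
  cong2∨ refl refl = refl

-- P ⊕ⁱⱼ Q: projection of conv {(x,y) ∈ P × Q : x_i = y_j} dropping y_j
oneSumPoly : ∀ {n₁ m₂} → Poly n₁ → Poly (suc m₂) → Fin n₁ → Fin (suc m₂) →
             Poly (n₁ + m₂)
oneSumPoly {n₁} {m₂} P Q i j z =
  Σ (Point (n₁ + suc m₂)) λ w → Conv T w × (∀ k → z k ≡ proj w k)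
  where
  T : Poly (n₁ + suc m₂)
  T w = P (λ u → w (u ↑ˡ suc m₂)) × Q (λ t → w (n₁ ↑ʳ t)) ×
        (w (i ↑ˡ suc m₂) ≡ w (n₁ ↑ʳ j))
  proj : Point (n₁ + suc m₂) → Point (n₁ + m₂)
  proj w k with splitAt n₁ k
  ... | inj₁ u = w (u ↑ˡ suc m₂)
  ... | inj₂ t = w (n₁ ↑ʳ punchIn j t)

CondC : Formulation → Set
CondC R = ∀ {n₁ m₂} (G₁ : Graph n₁) (G₂ : Graph (suc m₂))
  (v₁ : Fin n₁) (v₂ : Fin (suc m₂)) →
  ∀ z → R (oneSum G₁ G₂ v₁ v₂) z → oneSumPoly (R G₁) (R G₂) v₁ v₂ z

Is01 : ℚ → Set
Is01 q = (q ≡ 0ℚ) ⊎ (q ≡ 1ℚ)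

InUnitCube : ∀ {n} → Poly n → Set
InUnitCube P = ∀ x → P x → ∀ i → (0ℚ ≤ x i) × (x i ≤ 1ℚ)

HasPersistency : ∀ {n} → Poly n → Set
HasPersistency {n} P = InUnitCube P ×
  (∀ (c : Point n) (x : Point n) → P x → (∀ x' → P x' → dot c x' ≤ dot c x) →
    Σ (Point n) λ y → P y × (∀ i → Is01 (y i)) ×
      (∀ y' → P y' → (∀ i → Is01 (y' i)) → dot c y' ≤ dot c y) ×
      (∀ i → Is01 (x i) → y i ≡ x i))

IsK3 : ∀ {n} → Graph n → Set
IsK3 {n} G = (n ≡ 3) × (∀ u v → u ≢ v → Edge G u v)

RB : Formulation
RB G x = (IsK3 G × Redge G x) ⊎ (¬ IsK3 G × Pstab G x)

-- R^(B) is P_stab except on K₃, where it is R_edge(K₃) = conv(P_stab(K₃) ∪ {(½,½,½)}).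
--
-- (A) A facet a·x ≤ b of R(G) ⊇ P_stab(G) contains n affinely independent points.
-- Their restrictions to U = supp a lie on the face of P_stab(G[U]), and together with
-- the n − |U| unit vectors outside U they span the n homogenized points, so |U| of the
-- restrictions are affinely independent: a·x ≤ b is a facet of P_stab(G[U]). On K₃
-- every facet has a zero coefficient (a hyperplane with full support contains at
-- most two of the five vertices of R_edge(K₃)), so G[U] is a complete graph on at
-- most two vertices, where R_edge = P_stab.
--
-- (B) fails for the triangle plus an isolated vertex: x₀ + x₁ + x₂ ≤ 1 is a facet of
-- its stable set polytope, but its support induces K₃ and (½,½,½) ∈ R_edge(K₃).
--
-- (C) The restrictions of a point of R(G₁ ⊕ G₂) to the parts lie in R(G₁) and R(G₂):
-- for stable sets this is immediate, and if the 1-sum is K₃ both parts are complete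
-- graphs on at most three vertices, on which R_edge ⊆ R^(B).
--
-- Persistency: a maximiser is a convex combination of vertices, and every vertex of
-- positive weight is again a maximiser agreeing with it on its integral coordinates;
-- the only fractional vertex (½,½,½) has no integral coordinate.

module Submission where

open import Defs
open import Algebra.Bundles using (CommutativeRing)
import Algebra.Properties.Semiring.Sum as SemiringSum
open import Data.Bool using (Bool; true; false; not; _∨_)
import Data.Bool as Bool
open import Data.Bool.Properties using (∨-identityʳ)
open import Data.Empty using (⊥; ⊥-elim)
open import Data.Fin using (Fin; zero; suc; punchIn; punchOut; splitAt; _↑ˡ_; _↑ʳ_)
open import Data.Fin.Patterns using (0F; 1F; 2F; 3F; 4F)
import Data.Fin.Properties as Fin
open import Data.Fin.Subset using (Subset; inside; outside; _∈_; _∉_; ∁; ⁅_⁆) renaming (⊥ to ∅)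
open import Data.Fin.Subset.Properties
  using (_∈?_; x∉p⇒x∈∁p; x∈p⇒x∉∁p; ∉⊥; x∈⁅x⁆; x∈⁅y⁆⇒x≡y; x≢y⇒x∉⁅y⁆)
open import Data.Maybe using (just; nothing)
import Data.Maybe.Properties as Maybe
open import Data.Nat using (ℕ; zero; suc; z≤n; s≤s)
import Data.Nat as ℕ
import Data.Nat.Properties as ℕₚ
open import Data.Product using (Σ; ∃; ∃₂; _×_; _,_; proj₁; proj₂)
import Data.Product as Product
open import Data.Rational
  using (ℚ; 0ℚ; 1ℚ; ½; _+_; _*_; -_; _-_; _≤_; 1/_; ≢-nonZero; nonNegative)
open import Data.Rational.Properties
open import Data.Rational.Solver using (module +-*-Solver)
open import Data.Sum using (_⊎_; inj₁; inj₂; [_,_]′)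
open import Data.Unit using (tt)
open import Data.Vec using ([]; _∷_; lookup; tabulate; here; there)
open import Data.Vec.Functional as Vector using (_++_)
open import Data.Vec.Functional.Properties using (lookup-++ˡ; lookup-++ʳ)
open import Data.Vec.Properties using (lookup∘tabulate; []=⇒lookup; lookup⇒[]=)
open import Function using (_∘_; id)
open import Relation.Binary.PropositionalEquality
  using (_≡_; _≢_; refl; sym; trans; cong; cong₂; subst; subst₂; module ≡-Reasoning)
open import Relation.Nullary using (¬_; yes; no; Dec; does)
open import Relation.Nullary.Decidable using (¬?; _×-dec_; _→-dec_; toWitness; dec-true; decidable-stable)

open +-*-Solver using (solve; _:=_; _:+_; _:*_; _:-_; :-_; con)
open ≡-Reasoning


private
  module Σℚ = SemiringSum (CommutativeRing.semiring +-*-commutativeRing)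

sumFin≡sum : ∀ {k} (f : Fin k → ℚ) → sumFin f ≡ Σℚ.sum f
sumFin≡sum {zero}  f = refl
sumFin≡sum {suc k} f = cong (f zero +_) (sumFin≡sum (f ∘ suc))

sumFin-cong : ∀ {k} {f g : Fin k → ℚ} → (∀ i → f i ≡ g i) → sumFin f ≡ sumFin g
sumFin-cong {f = f} {g} f≗g = begin
  sumFin f    ≡⟨ sumFin≡sum f ⟩
  Σℚ.sum f    ≡⟨ Σℚ.sum-cong-≗ f≗g ⟩
  Σℚ.sum g    ≡⟨ sumFin≡sum g ⟨
  sumFin g    ∎

sumFin-zero : ∀ k → sumFin {k} (λ _ → 0ℚ) ≡ 0ℚ
sumFin-zero k = trans (sumFin≡sum {k} (λ _ → 0ℚ)) (Σℚ.sum-replicate-zero k)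

sumFin-distrib-+ : ∀ {k} (f g : Fin k → ℚ) →
  sumFin (λ i → f i + g i) ≡ sumFin f + sumFin g
sumFin-distrib-+ f g = begin
  sumFin (λ i → f i + g i)   ≡⟨ sumFin≡sum (λ i → f i + g i) ⟩
  Σℚ.sum (λ i → f i + g i)   ≡⟨ Σℚ.∑-distrib-+ f g ⟩
  Σℚ.sum f + Σℚ.sum g        ≡⟨ cong₂ _+_ (sumFin≡sum f) (sumFin≡sum g) ⟨
  sumFin f + sumFin g        ∎

*-distribˡ-sumFin : ∀ {k} c (f : Fin k → ℚ) → c * sumFin f ≡ sumFin (λ i → c * f i)
*-distribˡ-sumFin c f = begin
  c * sumFin f               ≡⟨ cong (c *_) (sumFin≡sum f) ⟩
  c * Σℚ.sum f               ≡⟨ Σℚ.*-distribˡ-sum c f ⟩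
  Σℚ.sum (λ i → c * f i)     ≡⟨ sumFin≡sum (λ i → c * f i) ⟨
  sumFin (λ i → c * f i)     ∎

*-distribʳ-sumFin : ∀ {k} c (f : Fin k → ℚ) → sumFin f * c ≡ sumFin (λ i → f i * c)
*-distribʳ-sumFin c f = begin
  sumFin f * c               ≡⟨ *-comm (sumFin f) c ⟩
  c * sumFin f               ≡⟨ *-distribˡ-sumFin c f ⟩
  sumFin (λ i → c * f i)     ≡⟨ sumFin-cong (λ i → *-comm c (f i)) ⟩
  sumFin (λ i → f i * c)     ∎

sumFin-distrib-- : ∀ {k} (f g : Fin k → ℚ) →
  sumFin (λ i → f i - g i) ≡ sumFin f - sumFin g
sumFin-distrib-- f g = begin
  sumFin (λ i → f i - g i)
    ≡⟨ sumFin-cong (λ i → solve 2 (λ x y → x :- y := x :+ (:- con 1ℚ) :* y) refl (f i) (g i)) ⟩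
  sumFin (λ i → f i + - 1ℚ * g i)        ≡⟨ sumFin-distrib-+ f _ ⟩
  sumFin f + sumFin (λ i → - 1ℚ * g i)   ≡⟨ cong (sumFin f +_) (*-distribˡ-sumFin (- 1ℚ) g) ⟨
  sumFin f + - 1ℚ * sumFin g             ≡⟨ solve 2 (λ x y → x :+ (:- con 1ℚ) :* y := x :- y) refl (sumFin f) (sumFin g) ⟩
  sumFin f - sumFin g                    ∎

sumFin-comm : ∀ {k m} (f : Fin k → Fin m → ℚ) →
  sumFin (λ i → sumFin (f i)) ≡ sumFin (λ j → sumFin (λ i → f i j))
sumFin-comm f = begin
  sumFin (λ i → sumFin (f i))               ≡⟨ sumFin-cong (λ i → sumFin≡sum (f i)) ⟩
  sumFin (λ i → Σℚ.sum (f i))               ≡⟨ sumFin≡sum (λ i → Σℚ.sum (f i)) ⟩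
  Σℚ.sum (λ i → Σℚ.sum (f i))               ≡⟨ Σℚ.∑-comm f ⟩
  Σℚ.sum (λ j → Σℚ.sum (λ i → f i j))       ≡⟨ sumFin≡sum (λ j → Σℚ.sum (λ i → f i j)) ⟨
  sumFin (λ j → Σℚ.sum (λ i → f i j))       ≡⟨ sumFin-cong (λ j → sumFin≡sum (λ i → f i j)) ⟨
  sumFin (λ j → sumFin (λ i → f i j))       ∎

sumFin-remove : ∀ {k} (i : Fin (suc k)) (f : Fin (suc k) → ℚ) →
  sumFin f ≡ f i + sumFin (f ∘ punchIn i)
sumFin-remove i f = begin
  sumFin f                      ≡⟨ sumFin≡sum f ⟩
  Σℚ.sum f                      ≡⟨ Σℚ.sum-remove f ⟩
  f i + Σℚ.sum (f ∘ punchIn i)  ≡⟨ cong (f i +_) (sumFin≡sum (f ∘ punchIn i)) ⟨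
  f i + sumFin (f ∘ punchIn i)  ∎

sumFin-single : ∀ {k} (i : Fin k) (f : Fin k → ℚ) →
  (∀ j → j ≢ i → f j ≡ 0ℚ) → sumFin f ≡ f i
sumFin-single {suc k} i f others≡0 = begin
  sumFin f                      ≡⟨ sumFin-remove i f ⟩
  f i + sumFin (f ∘ punchIn i)  ≡⟨ cong (f i +_) (sumFin-cong (λ j → others≡0 _ (Fin.punchInᵢ≢i i j))) ⟩
  f i + sumFin {k} (λ _ → 0ℚ)   ≡⟨ cong (f i +_) (sumFin-zero k) ⟩
  f i + 0ℚ                      ≡⟨ +-identityʳ (f i) ⟩
  f i                           ∎

0≤1 : 0ℚ ≤ 1ℚ
0≤1 = ≤ᵇ⇒≤ tt

0≤p+q : ∀ {p q} → 0ℚ ≤ p → 0ℚ ≤ q → 0ℚ ≤ p + q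
0≤p+q {p} {q} 0≤p 0≤q = subst (_≤ p + q) (+-identityˡ 0ℚ) (+-mono-≤ 0≤p 0≤q)

0≤p*q : ∀ {p q} → 0ℚ ≤ p → 0ℚ ≤ q → 0ℚ ≤ p * q
0≤p*q {p} {q} 0≤p 0≤q =
  subst (_≤ p * q) (*-zeroˡ q) (*-monoʳ-≤-nonNeg q {{nonNegative 0≤q}} 0≤p)

p≤q⇒0≤q-p : ∀ {p q} → p ≤ q → 0ℚ ≤ q - p
p≤q⇒0≤q-p {p} {q} p≤q = subst (_≤ q - p) (+-inverseʳ p) (+-monoˡ-≤ (- p) p≤q)

0≤q-p⇒p≤q : ∀ {p q} → 0ℚ ≤ q - p → p ≤ q
0≤q-p⇒p≤q {p} {q} 0≤q-p =
  subst₂ _≤_ (+-identityˡ p) (solve 2 (λ p q → (q :- p) :+ p := q) refl p q) (+-monoˡ-≤ p 0≤q-p)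

p-q≡0⇒p≡q : ∀ {p q} → p - q ≡ 0ℚ → p ≡ q
p-q≡0⇒p≡q {p} {q} p-q≡0 = begin
  p              ≡⟨ solve 2 (λ p q → p := (p :- q) :+ q) refl p q ⟩
  (p - q) + q    ≡⟨ cong (_+ q) p-q≡0 ⟩
  0ℚ + q         ≡⟨ +-identityˡ q ⟩
  q              ∎

p+q≡0⇒q≡-p : ∀ {p q} → p + q ≡ 0ℚ → q ≡ - p
p+q≡0⇒q≡-p {p} {q} p+q≡0 = begin
  q              ≡⟨ solve 2 (λ p q → q := (p :+ q) :- p) refl p q ⟩
  (p + q) - p    ≡⟨ cong (_- p) p+q≡0 ⟩
  0ℚ - p         ≡⟨ +-identityˡ (- p) ⟩
  - p            ∎

p≢0∧p*q≡0⇒q≡0 : ∀ {p q} → p ≢ 0ℚ → p * q ≡ 0ℚ → q ≡ 0ℚ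
p≢0∧p*q≡0⇒q≡0 {p} {q} p≢0 p*q≡0 = begin
  q                ≡⟨ *-identityˡ q ⟨
  1ℚ * q           ≡⟨ cong (_* q) (*-inverseˡ p {{≢-nonZero p≢0}}) ⟨
  (p⁻¹ * p) * q    ≡⟨ *-assoc p⁻¹ p q ⟩
  p⁻¹ * (p * q)    ≡⟨ cong (p⁻¹ *_) p*q≡0 ⟩
  p⁻¹ * 0ℚ         ≡⟨ *-zeroʳ p⁻¹ ⟩
  0ℚ               ∎
  where p⁻¹ = (1/ p) {{≢-nonZero p≢0}}

*-≢0 : ∀ {p q} → p ≢ 0ℚ → q ≢ 0ℚ → p * q ≢ 0ℚ
*-≢0 p≢0 q≢0 p*q≡0 = q≢0 (p≢0∧p*q≡0⇒q≡0 p≢0 p*q≡0)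

nonNeg+nonNeg≡0⇒≡0 : ∀ {p q} → 0ℚ ≤ p → 0ℚ ≤ q → p + q ≡ 0ℚ → p ≡ 0ℚ × q ≡ 0ℚ
nonNeg+nonNeg≡0⇒≡0 {p} {q} 0≤p 0≤q p+q≡0 = p≡0 , q≡0
  where
  p≡0 : p ≡ 0ℚ
  p≡0 = ≤-antisym (subst₂ _≤_ (+-identityʳ p) p+q≡0 (+-monoʳ-≤ p 0≤q)) 0≤p
  q≡0 : q ≡ 0ℚ
  q≡0 = ≤-antisym (subst₂ _≤_ (+-identityˡ q) p+q≡0 (+-monoˡ-≤ q 0≤p)) 0≤q

sumFin-nonNeg : ∀ {k} (f : Fin k → ℚ) → (∀ i → 0ℚ ≤ f i) → 0ℚ ≤ sumFin f
sumFin-nonNeg {zero}  f f≥0 = ≤-refl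
sumFin-nonNeg {suc k} f f≥0 = 0≤p+q (f≥0 zero) (sumFin-nonNeg (f ∘ suc) (f≥0 ∘ suc))

sumFin-mono-≤ : ∀ {k} (f g : Fin k → ℚ) → (∀ i → f i ≤ g i) → sumFin f ≤ sumFin g
sumFin-mono-≤ {zero}  f g f≤g = ≤-refl
sumFin-mono-≤ {suc k} f g f≤g = +-mono-≤ (f≤g zero) (sumFin-mono-≤ (f ∘ suc) (g ∘ suc) (f≤g ∘ suc))

nonNeg-sumFin≡0⇒≡0 : ∀ {k} (f : Fin k → ℚ) → (∀ i → 0ℚ ≤ f i) → sumFin f ≡ 0ℚ → ∀ i → f i ≡ 0ℚ
nonNeg-sumFin≡0⇒≡0 f f≥0 Σf≡0 zero =
  proj₁ (nonNeg+nonNeg≡0⇒≡0 (f≥0 zero) (sumFin-nonNeg (f ∘ suc) (f≥0 ∘ suc)) Σf≡0)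
nonNeg-sumFin≡0⇒≡0 f f≥0 Σf≡0 (suc i) = nonNeg-sumFin≡0⇒≡0 (f ∘ suc) (f≥0 ∘ suc)
  (proj₂ (nonNeg+nonNeg≡0⇒≡0 (f≥0 zero) (sumFin-nonNeg (f ∘ suc) (f≥0 ∘ suc)) Σf≡0)) i

convexCombination-≤ : ∀ {k} (μ f : Fin k → ℚ) (d : ℚ) → (∀ i → 0ℚ ≤ μ i) → sumFin μ ≡ 1ℚ →
  (∀ i → f i ≤ d) → sumFin (λ i → μ i * f i) ≤ d
convexCombination-≤ μ f d μ≥0 Σμ≡1 f≤d = subst (sumFin (λ i → μ i * f i) ≤_) Σμd≡d
  (sumFin-mono-≤ _ _ (λ i → *-monoˡ-≤-nonNeg (μ i) {{nonNegative (μ≥0 i)}} (f≤d i)))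
  where
  Σμd≡d : sumFin (λ i → μ i * d) ≡ d
  Σμd≡d = begin
    sumFin (λ i → μ i * d)  ≡⟨ *-distribʳ-sumFin d μ ⟨
    sumFin μ * d            ≡⟨ cong (_* d) Σμ≡1 ⟩
    1ℚ * d                  ≡⟨ *-identityˡ d ⟩
    d                       ∎

-- Linear dependence and rank

sumFin-++ : ∀ {m n} (f : Fin (m ℕ.+ n) → ℚ) →
  sumFin f ≡ sumFin (λ i → f (i ↑ˡ n)) + sumFin (λ i → f (m ↑ʳ i))
sumFin-++ {zero}  f = sym (+-identityˡ (sumFin f))
sumFin-++ {suc m} {n} f = trans (cong (f zero +_) (sumFin-++ {m} {n} (f ∘ suc)))
  (sym (+-assoc (f zero) (sumFin (λ i → f (suc i ↑ˡ n))) (sumFin (λ i → f (suc m ↑ʳ i)))))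

lincomb : ∀ {m n} → (Fin m → ℚ) → (Fin m → Fin n → ℚ) → Fin n → ℚ
lincomb μ v j = sumFin (λ i → μ i * v i j)

LinearlyIndependent : ∀ {m n} → (Fin m → Fin n → ℚ) → Set
LinearlyIndependent v = ∀ μ → (∀ j → lincomb μ v j ≡ 0ℚ) → ∀ i → μ i ≡ 0ℚ

LinearlyDependent : ∀ {m n} → (Fin m → Fin n → ℚ) → Set
LinearlyDependent v = ∃ λ μ → (∀ j → lincomb μ v j ≡ 0ℚ) × ∃ λ i → μ i ≢ 0ℚ

InSpan : ∀ {s n} → (Fin s → Fin n → ℚ) → (Fin n → ℚ) → Set
InSpan v y = ∃ λ c → ∀ j → y j ≡ lincomb c v j

lincomb-++ : ∀ {s t n} (c : Fin s → ℚ) (d : Fin t → ℚ) (v : Fin s → Fin n → ℚ) (w : Fin t → Fin n → ℚ) j →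
  lincomb (c ++ d) (v ++ w) j ≡ lincomb c v j + lincomb d w j
lincomb-++ {s} {t} c d v w j = trans (sumFin-++ {s} {t} _) (cong₂ _+_
  (sumFin-cong (λ i → cong₂ (λ a x → a * x j) (lookup-++ˡ c d i) (lookup-++ˡ v w i)))
  (sumFin-cong (λ i → cong₂ (λ a x → a * x j) (lookup-++ʳ c d i) (lookup-++ʳ v w i))))

lincomb-lincomb : ∀ {k s n} (ν : Fin k → ℚ) (C : Fin k → Fin s → ℚ) (v : Fin s → Fin n → ℚ) j →
  lincomb ν (λ i → lincomb (C i) v) j ≡ lincomb (lincomb ν C) v j
lincomb-lincomb ν C v j = begin
  sumFin (λ i → ν i * sumFin (λ l → C i l * v l j))
    ≡⟨ sumFin-cong (λ i → trans (*-distribˡ-sumFin (ν i) (λ l → C i l * v l j))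
                                (sumFin-cong (λ l → sym (*-assoc (ν i) (C i l) (v l j))))) ⟩
  sumFin (λ i → sumFin (λ l → ν i * C i l * v l j))
    ≡⟨ sumFin-comm (λ i l → ν i * C i l * v l j) ⟩
  sumFin (λ l → sumFin (λ i → ν i * C i l * v l j))
    ≡⟨ sumFin-cong (λ l → *-distribʳ-sumFin (v l j) (λ i → ν i * C i l)) ⟨
  sumFin (λ l → sumFin (λ i → ν i * C i l) * v l j) ∎

lincomb-zeroˡ : ∀ {m n} (v : Fin m → Fin n → ℚ) j → lincomb (λ _ → 0ℚ) v j ≡ 0ℚ
lincomb-zeroˡ {m} v j = trans (sumFin-cong (λ i → *-zeroˡ (v i j))) (sumFin-zero m)

lincomb-zeroʳ : ∀ {m n} (μ : Fin m → ℚ) (v : Fin m → Fin n → ℚ) j →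
  (∀ i → v i j ≡ 0ℚ) → lincomb μ v j ≡ 0ℚ
lincomb-zeroʳ {m} μ v j v≡0 = trans (sumFin-cong (λ i → trans (cong (μ i *_) (v≡0 i)) (*-zeroʳ (μ i)))) (sumFin-zero m)

nonzero-or-zero : ∀ {m} (f : Fin m → ℚ) → (∃ λ i → f i ≢ 0ℚ) ⊎ (∀ i → f i ≡ 0ℚ)
nonzero-or-zero {m} f with Fin.all? (λ i → f i ≟ 0ℚ)
... | yes f≡0 = inj₂ f≡0
... | no  f≢0 = inj₁ (Fin.¬∀⟶∃¬ m _ (λ i → f i ≟ 0ℚ) f≢0)

-- Gaussian elimination of the first column with pivot row i₀: the remaining
-- rows become  p v_k − v_k0 v_i₀  (p = v_i₀0), with the first entry dropped.
module Elimination {m n : ℕ} (v : Fin (suc m) → Fin (suc n) → ℚ) (i₀ : Fin (suc m)) where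

  p : ℚ
  p = v i₀ zero

  row : Fin m → Fin (suc m)
  row = punchIn i₀

  reduced : Fin m → Fin n → ℚ
  reduced k j = p * v (row k) (suc j) - v (row k) zero * v i₀ (suc j)

  lincomb-reduced : ∀ ν j →
    lincomb ν reduced j ≡ p * lincomb ν (λ k → v (row k) ∘ suc) j - lincomb ν (λ k → v (row k)) zero * v i₀ (suc j)
  lincomb-reduced ν j = begin
    sumFin (λ k → ν k * (p * v (row k) (suc j) - v (row k) zero * c))
      ≡⟨ sumFin-cong (λ k → solve 5 (λ ν p a b c → ν :* (p :* a :- b :* c) := p :* (ν :* a) :- ν :* b :* c) refl
                                     (ν k) p (v (row k) (suc j)) (v (row k) zero) c) ⟩
    sumFin (λ k → p * (ν k * v (row k) (suc j)) - ν k * v (row k) zero * c)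
      ≡⟨ sumFin-distrib-- (λ k → p * (ν k * v (row k) (suc j))) (λ k → ν k * v (row k) zero * c) ⟩
    sumFin (λ k → p * (ν k * v (row k) (suc j))) - sumFin (λ k → ν k * v (row k) zero * c)
      ≡⟨ cong₂ _-_ (*-distribˡ-sumFin p (λ k → ν k * v (row k) (suc j))) (*-distribʳ-sumFin c (λ k → ν k * v (row k) zero)) ⟨
    p * lincomb ν (λ k → v (row k) ∘ suc) j - lincomb ν (λ k → v (row k)) zero * c ∎
    where c = v i₀ (suc j)

  lincomb-split : ∀ (μ : Fin (suc m) → ℚ) j → lincomb μ v j ≡ μ i₀ * v i₀ j + lincomb (μ ∘ row) (v ∘ row) j
  lincomb-split μ j = sumFin-remove i₀ (λ i → μ i * v i j)

  lift : (Fin m → ℚ) → Fin (suc m) → ℚ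
  lift ν i with i Fin.≟ i₀
  ... | yes _   = - lincomb ν (v ∘ row) zero
  ... | no  i≢i₀ = p * ν (punchOut (i≢i₀ ∘ sym))

  lift-pivot : ∀ ν → lift ν i₀ ≡ - lincomb ν (v ∘ row) zero
  lift-pivot ν with i₀ Fin.≟ i₀
  ... | yes _   = refl
  ... | no  i≢i = ⊥-elim (i≢i refl)

  lift-row : ∀ ν k → lift ν (row k) ≡ p * ν k
  lift-row ν k with row k Fin.≟ i₀
  ... | yes r≡i₀ = ⊥-elim (Fin.punchInᵢ≢i i₀ k r≡i₀)
  ... | no  _    = cong (λ t → p * ν t) (trans (Fin.punchOut-cong i₀ refl) (Fin.punchOut-punchIn i₀))

  lift-dependence : ∀ ν → (∀ j → lincomb ν reduced j ≡ 0ℚ) → ∀ j → lincomb (lift ν) v j ≡ 0ℚ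
  lift-dependence ν ν-reduced≡0 j = begin
    lincomb (lift ν) v j
      ≡⟨ lincomb-split (lift ν) j ⟩
    lift ν i₀ * v i₀ j + lincomb (lift ν ∘ row) (v ∘ row) j
      ≡⟨ cong₂ _+_ (cong (_* v i₀ j) (lift-pivot ν))
                   (sumFin-cong (λ k → trans (cong (_* v (row k) j) (lift-row ν k)) (*-assoc p (ν k) _))) ⟩
    - S * v i₀ j + sumFin (λ k → p * (ν k * v (row k) j))
      ≡⟨ cong (- S * v i₀ j +_) (*-distribˡ-sumFin p (λ k → ν k * v (row k) j)) ⟨
    - S * v i₀ j + p * lincomb ν (v ∘ row) j
      ≡⟨ rest j ⟩
    0ℚ ∎
    where
    S = lincomb ν (v ∘ row) zero
    rest : ∀ j → - S * v i₀ j + p * lincomb ν (v ∘ row) j ≡ 0ℚ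
    rest zero    = solve 2 (λ s p → (:- s) :* p :+ p :* s := con 0ℚ) refl S p
    rest (suc j) = begin
      - S * v i₀ (suc j) + p * lincomb ν (v ∘ row) (suc j)
        ≡⟨ solve 3 (λ s c a → (:- s) :* c :+ a := a :- s :* c) refl S (v i₀ (suc j)) _ ⟩
      p * lincomb ν (v ∘ row) (suc j) - S * v i₀ (suc j)
        ≡⟨ lincomb-reduced ν j ⟨
      lincomb ν reduced j
        ≡⟨ ν-reduced≡0 j ⟩
      0ℚ ∎

  restrict-dependence : ∀ μ → (∀ j → lincomb μ v j ≡ 0ℚ) → ∀ j → lincomb (μ ∘ row) reduced j ≡ 0ℚ
  restrict-dependence μ μv≡0 j = begin
    lincomb (μ ∘ row) reduced j
      ≡⟨ lincomb-reduced (μ ∘ row) j ⟩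
    p * lincomb (μ ∘ row) (v ∘ row) (suc j) - lincomb (μ ∘ row) (v ∘ row) zero * c
      ≡⟨ cong₂ (λ x y → p * x - y * c) (rows≡ (suc j)) (rows≡ zero) ⟩
    p * - (μ i₀ * c) - - (μ i₀ * p) * c
      ≡⟨ solve 3 (λ p c m → p :* (:- (m :* c)) :- (:- (m :* p)) :* c := con 0ℚ) refl p c (μ i₀) ⟩
    0ℚ ∎
    where
    c = v i₀ (suc j)
    rows≡ : ∀ j → lincomb (μ ∘ row) (v ∘ row) j ≡ - (μ i₀ * v i₀ j)
    rows≡ j = p+q≡0⇒q≡-p (trans (sym (lincomb-split μ j)) (μv≡0 j))

independent-or-dependent : ∀ {m n} (v : Fin m → Fin n → ℚ) →
  (LinearlyIndependent v × m ℕ.≤ n) ⊎ LinearlyDependent v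
independent-or-dependent {zero}  v = inj₁ ((λ _ _ ()) , z≤n)
independent-or-dependent {suc m} {zero} v = inj₂ ((λ _ → 1ℚ) , (λ ()) , zero , 1≢0)
independent-or-dependent {suc m} {suc n} v with nonzero-or-zero (λ i → v i zero)
... | inj₂ column≡0 with independent-or-dependent (λ i → v i ∘ suc)
...   | inj₁ (indep , m≤n) = inj₁ ((λ μ μv≡0 → indep μ (μv≡0 ∘ suc)) , ℕₚ.m≤n⇒m≤1+n m≤n)
...   | inj₂ (μ , μv≡0 , i , μi≢0) = inj₂ (μ , all≡0 , i , μi≢0)
  where
  all≡0 : ∀ j → lincomb μ v j ≡ 0ℚ
  all≡0 zero    = lincomb-zeroʳ μ v zero column≡0
  all≡0 (suc j) = μv≡0 j
independent-or-dependent {suc m} {suc n} v | inj₁ (i₀ , p≢0) with independent-or-dependent (Elimination.reduced v i₀)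
... | inj₂ (ν , νw≡0 , k , νk≢0) =
  inj₂ (lift ν , lift-dependence ν νw≡0 , row k , subst (_≢ 0ℚ) (sym (lift-row ν k)) (*-≢0 p≢0 νk≢0))
  where open Elimination v i₀
... | inj₁ (indep , m≤n) = inj₁ (indepᵥ , s≤s m≤n)
  where
  open Elimination v i₀
  indepᵥ : LinearlyIndependent v
  indepᵥ μ μv≡0 i with i Fin.≟ i₀
  ... | no i≢i₀  = trans (cong μ (sym (Fin.punchIn-punchOut (i≢i₀ ∘ sym)))) (rows≡0 _)
    where rows≡0 = indep (μ ∘ row) (restrict-dependence μ μv≡0)
  ... | yes refl = p≢0∧p*q≡0⇒q≡0 p≢0 (begin
    p * μ i₀                                      ≡⟨ *-comm p (μ i₀) ⟩
    μ i₀ * p                                      ≡⟨ +-identityʳ _ ⟨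
    μ i₀ * p + 0ℚ                                 ≡⟨ cong (μ i₀ * p +_) (lincomb-zeroˡ′ (v ∘ row)) ⟨
    μ i₀ * p + lincomb (μ ∘ row) (v ∘ row) zero   ≡⟨ lincomb-split μ zero ⟨
    lincomb μ v zero                              ≡⟨ μv≡0 zero ⟩
    0ℚ                                            ∎)
    where
    rows≡0 = indep (μ ∘ row) (restrict-dependence μ μv≡0)
    lincomb-zeroˡ′ : ∀ w → lincomb (μ ∘ row) w zero ≡ 0ℚ
    lincomb-zeroˡ′ w = trans (sumFin-cong (λ k → cong (_* w k zero) (rows≡0 k))) (lincomb-zeroˡ w zero)

independent⇒≤ : ∀ {m n} (v : Fin m → Fin n → ℚ) → LinearlyIndependent v → m ℕ.≤ n
independent⇒≤ v indep with independent-or-dependent v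
... | inj₁ (_ , m≤n) = m≤n
... | inj₂ (μ , μv≡0 , i , μi≢0) = ⊥-elim (μi≢0 (indep μ μv≡0 i))

independent-in-span⇒≤ : ∀ {s k n} (x : Fin s → Fin n → ℚ) (y : Fin k → Fin n → ℚ) →
  (∀ i → InSpan x (y i)) → LinearlyIndependent y → k ℕ.≤ s
independent-in-span⇒≤ {s} {k} x y y∈span indep = independent⇒≤ C indepC
  where
  C : Fin k → Fin s → ℚ
  C i = proj₁ (y∈span i)
  indepC : LinearlyIndependent C
  indepC ν νC≡0 = indep ν (λ j → begin
    lincomb ν y j                    ≡⟨ sumFin-cong (λ i → cong (ν i *_) (proj₂ (y∈span i) j)) ⟩
    lincomb ν (λ i → lincomb (C i) x) j ≡⟨ lincomb-lincomb ν C x j ⟩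
    lincomb (lincomb ν C) x j        ≡⟨ sumFin-cong (λ l → cong (_* x l j) (νC≡0 l)) ⟩
    lincomb (λ _ → 0ℚ) x j           ≡⟨ lincomb-zeroˡ x j ⟩
    0ℚ                               ∎)

InSpan-∷ : ∀ {s n} (a : Fin n → ℚ) (v : Fin s → Fin n → ℚ) {y} → InSpan v y → InSpan (a Vector.∷ v) y
InSpan-∷ a v {y} (c , y≡cv) = 0ℚ Vector.∷ c , λ j → begin
  y j                            ≡⟨ y≡cv j ⟩
  lincomb c v j                  ≡⟨ +-identityˡ _ ⟨
  0ℚ + lincomb c v j             ≡⟨ cong (_+ lincomb c v j) (*-zeroˡ (a j)) ⟨
  0ℚ * a j + lincomb c v j       ∎

InSpan-head : ∀ {s n} (a : Fin n → ℚ) (v : Fin s → Fin n → ℚ) → InSpan (a Vector.∷ v) a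
InSpan-head {s} a v = 1ℚ Vector.∷ (λ _ → 0ℚ) , λ j → sym (begin
  1ℚ * a j + lincomb (λ _ → 0ℚ) v j  ≡⟨ cong₂ _+_ (*-identityˡ (a j)) (lincomb-zeroˡ v j) ⟩
  a j + 0ℚ                          ≡⟨ +-identityʳ (a j) ⟩
  a j                               ∎)

dependence-head-InSpan : ∀ {s n} (a : Fin n → ℚ) (v : Fin s → Fin n → ℚ) (μ : Fin (suc s) → ℚ) →
  (∀ j → lincomb μ (a Vector.∷ v) j ≡ 0ℚ) → μ zero ≢ 0ℚ → InSpan v a
dependence-head-InSpan a v μ μav≡0 μ₀≢0 = (λ l → - (μ₀⁻¹ * μ (suc l))) , λ j → sym (begin
  sumFin (λ l → - (μ₀⁻¹ * μ (suc l)) * v l j)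
    ≡⟨ sumFin-cong (λ l → solve 3 (λ c m y → (:- (c :* m)) :* y := (:- c) :* (m :* y)) refl μ₀⁻¹ (μ (suc l)) (v l j)) ⟩
  sumFin (λ l → - μ₀⁻¹ * (μ (suc l) * v l j))  ≡⟨ *-distribˡ-sumFin (- μ₀⁻¹) (λ l → μ (suc l) * v l j) ⟨
  - μ₀⁻¹ * lincomb (μ ∘ suc) v j               ≡⟨ cong (- μ₀⁻¹ *_) (p+q≡0⇒q≡-p (μav≡0 j)) ⟩
  - μ₀⁻¹ * - (μ zero * a j)                    ≡⟨ solve 3 (λ c m x → (:- c) :* (:- (m :* x)) := (c :* m) :* x) refl μ₀⁻¹ (μ zero) (a j) ⟩
  (μ₀⁻¹ * μ zero) * a j                        ≡⟨ cong (_* a j) (*-inverseˡ (μ zero) {{≢-nonZero μ₀≢0}}) ⟩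
  1ℚ * a j                                     ≡⟨ *-identityˡ (a j) ⟩
  a j                                          ∎)
  where μ₀⁻¹ = (1/ μ zero) {{≢-nonZero μ₀≢0}}

SpanningIndependentSubfamily : ∀ {k n} → (Fin k → Fin n → ℚ) → Set
SpanningIndependentSubfamily {k} x = Σ ℕ λ s → Σ (Fin s → Fin k) λ σ →
  LinearlyIndependent (x ∘ σ) × (∀ i → InSpan (x ∘ σ) (x i))

spanningIndependentSubfamily : ∀ {k n} (x : Fin k → Fin n → ℚ) → SpanningIndependentSubfamily x
spanningIndependentSubfamily {zero} x = 0 , (λ ()) , (λ _ _ ()) , λ ()
spanningIndependentSubfamily {suc k} x with spanningIndependentSubfamily (x ∘ suc)
... | s , σ , indep , spans with independent-or-dependent (x zero Vector.∷ (x ∘ suc ∘ σ))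
...   | inj₁ (indep′ , _) = suc s , zero Vector.∷ (suc ∘ σ) , indep′ , spans′
  where
  spans′ : ∀ i → InSpan (x zero Vector.∷ (x ∘ suc ∘ σ)) (x i)
  spans′ zero    = InSpan-head (x zero) (x ∘ suc ∘ σ)
  spans′ (suc i) = InSpan-∷ (x zero) (x ∘ suc ∘ σ) (spans i)
...   | inj₂ (μ , μx≡0 , i , μi≢0) with μ zero ≟ 0ℚ
...     | no μ₀≢0 = s , suc ∘ σ , indep , spans′
  where
  spans′ : ∀ i → InSpan (x ∘ suc ∘ σ) (x i)
  spans′ zero    = dependence-head-InSpan (x zero) (x ∘ suc ∘ σ) μ μx≡0 μ₀≢0
  spans′ (suc i) = spans i
...     | yes μ₀≡0 = ⊥-elim (μi≢0 (μ≡0 i))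
  where
  μ≡0 : ∀ i → μ i ≡ 0ℚ
  μ≡0 zero    = μ₀≡0
  μ≡0 (suc l) = indep (μ ∘ suc) tail≡0 l
    where
    tail≡0 : ∀ j → lincomb (μ ∘ suc) (x ∘ suc ∘ σ) j ≡ 0ℚ
    tail≡0 j = begin
      lincomb (μ ∘ suc) (x ∘ suc ∘ σ) j                       ≡⟨ +-identityˡ _ ⟨
      0ℚ + lincomb (μ ∘ suc) (x ∘ suc ∘ σ) j                  ≡⟨ cong (_+ lincomb (μ ∘ suc) (x ∘ suc ∘ σ) j) μ₀x₀≡0 ⟨
      μ zero * x zero j + lincomb (μ ∘ suc) (x ∘ suc ∘ σ) j   ≡⟨ μx≡0 j ⟩
      0ℚ                                                      ∎
      where μ₀x₀≡0 = trans (cong (_* x zero j) μ₀≡0) (*-zeroˡ (x zero j))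

-- Affine independence and dimension

homogenize : ∀ {n} → Point n → Fin (suc n) → ℚ
homogenize x = 1ℚ Vector.∷ x

lincomb-homogenize : ∀ {k n} (μ : Fin k → ℚ) (p : Fin k → Point n) →
  lincomb μ (homogenize ∘ p) zero ≡ sumFin μ
lincomb-homogenize μ p = sumFin-cong (λ i → *-identityʳ (μ i))

affIndep⇒independent : ∀ {k n} (p : Fin k → Point n) → AffIndep p → LinearlyIndependent (homogenize ∘ p)
affIndep⇒independent p indep μ μp≡0 =
  indep μ (trans (sym (lincomb-homogenize μ p)) (μp≡0 zero)) (μp≡0 ∘ suc)

independent⇒affIndep : ∀ {k n} (p : Fin k → Point n) → LinearlyIndependent (homogenize ∘ p) → AffIndep p
independent⇒affIndep p indep μ Σμ≡0 μp≡0 = indep μ μhp≡0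
  where
  μhp≡0 : ∀ j → lincomb μ (homogenize ∘ p) j ≡ 0ℚ
  μhp≡0 zero    = trans (lincomb-homogenize μ p) Σμ≡0
  μhp≡0 (suc j) = μp≡0 j

affIndep⇒≤ : ∀ {k n} (p : Fin k → Point n) → AffIndep p → k ℕ.≤ suc n
affIndep⇒≤ p indep = independent⇒≤ (homogenize ∘ p) (affIndep⇒independent p indep)

¬HasAffIndep : ∀ {n k} (P : Poly n) → suc n ℕ.< k → ¬ HasAffIndep P k
¬HasAffIndep P n+1<k (p , _ , indep) = ℕₚ.<⇒≱ n+1<k (affIndep⇒≤ p indep)

AffIndep-∘suc : ∀ {k n} (p : Fin (suc k) → Point n) → AffIndep p → AffIndep (p ∘ suc)
AffIndep-∘suc p indep μ Σμ≡0 μp≡0 i = indep (0ℚ Vector.∷ μ) (trans (+-identityˡ _) Σμ≡0) μ′p≡0 (suc i)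
  where
  μ′p≡0 : ∀ j → lincomb (0ℚ Vector.∷ μ) p j ≡ 0ℚ
  μ′p≡0 j = trans (cong (_+ lincomb μ (p ∘ suc) j) (*-zeroˡ (p zero j))) (trans (+-identityˡ _) (μp≡0 j))

HasAffIndep-mono : ∀ {n k k′} (P : Poly n) → k′ ℕ.≤ k → HasAffIndep P k → HasAffIndep P k′
HasAffIndep-mono {k = k} {k′} P k′≤k hasₖ with ℕₚ.m≤n⇒∃[o]m+o≡n k′≤k
... | o , refl = drop o hasₖ
  where
  drop : ∀ o → HasAffIndep P (k′ ℕ.+ o) → HasAffIndep P k′
  drop zero    has = subst (HasAffIndep P) (ℕₚ.+-identityʳ k′) has
  drop (suc o) has with subst (HasAffIndep P) (ℕₚ.+-suc k′ o) has
  ... | p , p∈P , indep = drop o (p ∘ suc , p∈P ∘ suc , AffIndep-∘suc p indep)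

HasAffIndep-⊆ : ∀ {n k} {P Q : Poly n} → (∀ x → P x → Q x) → HasAffIndep P k → HasAffIndep Q k
HasAffIndep-⊆ P⊆Q (p , p∈P , indep) = p , (λ i → P⊆Q (p i) (p∈P i)) , indep

dot-cong : ∀ {n} (a : Point n) {x y : Point n} → (∀ j → x j ≡ y j) → dot a x ≡ dot a y
dot-cong a x≗y = sumFin-cong (λ j → cong (a j *_) (x≗y j))

dot-zeroˡ : ∀ {n} (a x : Point n) → (∀ i → a i ≡ 0ℚ) → dot a x ≡ 0ℚ
dot-zeroˡ {n} a x a≡0 = trans (sumFin-cong (λ i → trans (cong (_* x i) (a≡0 i)) (*-zeroˡ (x i)))) (sumFin-zero n)

dot-zeroʳ : ∀ {n} (a x : Point n) → (∀ i → x i ≡ 0ℚ) → dot a x ≡ 0ℚ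
dot-zeroʳ {n} a x x≡0 = trans (sumFin-cong (λ i → trans (cong (a i *_) (x≡0 i)) (*-zeroʳ (a i)))) (sumFin-zero n)

dot-lincomb : ∀ {n k} (a : Point n) (μ : Fin k → ℚ) (p : Fin k → Point n) →
  dot a (lincomb μ p) ≡ sumFin (λ i → μ i * dot a (p i))
dot-lincomb a μ p = begin
  sumFin (λ j → a j * sumFin (λ i → μ i * p i j))
    ≡⟨ sumFin-cong (λ j → *-distribˡ-sumFin (a j) (λ i → μ i * p i j)) ⟩
  sumFin (λ j → sumFin (λ i → a j * (μ i * p i j)))
    ≡⟨ sumFin-comm (λ j i → a j * (μ i * p i j)) ⟩
  sumFin (λ i → sumFin (λ j → a j * (μ i * p i j)))
    ≡⟨ sumFin-cong (λ i → sumFin-cong (λ j → solve 3 (λ x y z → x :* (y :* z) := y :* (x :* z)) refl (a j) (μ i) (p i j))) ⟩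
  sumFin (λ i → sumFin (λ j → μ i * (a j * p i j)))
    ≡⟨ sumFin-cong (λ i → *-distribˡ-sumFin (μ i) (λ j → a j * p i j)) ⟨
  sumFin (λ i → μ i * dot a (p i)) ∎

-- Dropping a coordinate i₀ with a i₀ ≠ 0 keeps the points affinely independent.
hyperplane-affIndep⇒≤ : ∀ {k m} (a : Point m) (b : ℚ) (i₀ : Fin m) → a i₀ ≢ 0ℚ →
  (p : Fin k → Point m) → (∀ i → dot a (p i) ≡ b) → AffIndep p → k ℕ.≤ m
hyperplane-affIndep⇒≤ {k} {suc m} a b i₀ ai₀≢0 p on-hyperplane indep =
  independent⇒≤ (λ i → homogenize (p i ∘ punchIn i₀)) (affIndep⇒independent (λ i → p i ∘ punchIn i₀) indep′)
  where
  indep′ : AffIndep (λ i → p i ∘ punchIn i₀)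
  indep′ μ Σμ≡0 μp′≡0 = indep μ Σμ≡0 μp≡0
    where
    x = lincomb μ p
    ax≡0 : a i₀ * x i₀ ≡ 0ℚ
    ax≡0 = begin
      a i₀ * x i₀                                            ≡⟨ +-identityʳ _ ⟨
      a i₀ * x i₀ + 0ℚ                                       ≡⟨ cong (a i₀ * x i₀ +_) (dot-zeroʳ (a ∘ punchIn i₀) (x ∘ punchIn i₀) μp′≡0) ⟨
      a i₀ * x i₀ + dot (a ∘ punchIn i₀) (x ∘ punchIn i₀)    ≡⟨ sumFin-remove i₀ (λ j → a j * x j) ⟨
      dot a x                                                ≡⟨ dot-lincomb a μ p ⟩
      sumFin (λ i → μ i * dot a (p i))                       ≡⟨ sumFin-cong (λ i → cong (μ i *_) (on-hyperplane i)) ⟩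
      sumFin (λ i → μ i * b)                                 ≡⟨ *-distribʳ-sumFin b μ ⟨
      sumFin μ * b                                           ≡⟨ cong (_* b) Σμ≡0 ⟩
      0ℚ * b                                                 ≡⟨ *-zeroˡ b ⟩
      0ℚ                                                     ∎
    μp≡0 : ∀ j → x j ≡ 0ℚ
    μp≡0 j with j Fin.≟ i₀
    ... | yes refl = p≢0∧p*q≡0⇒q≡0 ai₀≢0 ax≡0
    ... | no  j≢i₀ = subst (λ j → x j ≡ 0ℚ) (Fin.punchIn-punchOut (j≢i₀ ∘ sym)) (μp′≡0 _)

facetDefining⇒nonzero : ∀ {n} (P : Poly n) a b → FacetDefining P a b → ∃ λ i → a i ≢ 0ℚ
facetDefining⇒nonzero P a b (_ , d , hasP , _ , (q , q∈F , _) , ¬hasF) with nonzero-or-zero a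
... | inj₁ nonzero = nonzero
... | inj₂ a≡0 = ⊥-elim (¬hasF (HasAffIndep-⊆ {P = P} (λ x x∈P → x∈P , trans (dot-zeroˡ a x a≡0) 0≡b) hasP))
  where
  0≡b : 0ℚ ≡ b
  0≡b = trans (sym (dot-zeroˡ a (q zero) a≡0)) (proj₂ (q∈F zero))

full-facetDefining⇒face-dim : ∀ {n} (P : Poly n) a b → HasAffIndep P (suc n) → FacetDefining P a b →
  HasAffIndep (Face P a b) n
full-facetDefining⇒face-dim {n} P a b full (_ , d , (p , _ , indep) , ¬has , hasF , _) =
  subst (HasAffIndep (Face P a b)) (sym n≡1+d) hasF
  where
  n≡1+d : n ≡ suc d
  n≡1+d with suc n ℕ.≤? 2 ℕ.+ d
  ... | yes n+1≤d+2 = ℕₚ.suc-injective (ℕₚ.≤-antisym n+1≤d+2 (affIndep⇒≤ p indep))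
  ... | no  n+1≰d+2 = ⊥-elim (¬has (HasAffIndep-mono P (ℕₚ.≰⇒> n+1≰d+2) full))

facetDefining-intro : ∀ {n} (P : Poly n) a b → HasAffIndep P (suc n) → Valid P a b →
  (∃ λ i → a i ≢ 0ℚ) → HasAffIndep (Face P a b) n → FacetDefining P a b
facetDefining-intro {suc n} P a b full valid (i , ai≢0) hasF =
  valid , n , full , ¬HasAffIndep P ℕₚ.≤-refl , hasF ,
  λ { (p , p∈F , indep) → ℕₚ.<⇒≱ ℕₚ.≤-refl (hyperplane-affIndep⇒≤ a b i ai≢0 p (proj₂ ∘ p∈F) indep) }

emb-∈ : ∀ {n} (U : Subset n) i → emb U i ∈ U
emb-∈ (inside ∷ U)  zero    = here
emb-∈ (inside ∷ U)  (suc i) = there (emb-∈ U i)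
emb-∈ (outside ∷ U) i       = there (emb-∈ U i)

emb-injective : ∀ {n} (U : Subset n) {i i′} → emb U i ≡ emb U i′ → i ≡ i′
emb-injective (inside ∷ U)  {zero}  {zero}   _  = refl
emb-injective (inside ∷ U)  {suc i} {suc i′} eq = cong suc (emb-injective U (Fin.suc-injective eq))
emb-injective (outside ∷ U) eq = emb-injective U (Fin.suc-injective eq)

∈⇒∃emb : ∀ {n} (U : Subset n) {j} → j ∈ U → ∃ λ i → emb U i ≡ j
∈⇒∃emb (inside ∷ U)  here          = zero , refl
∈⇒∃emb (inside ∷ U)  (there j∈U)   = Product.map suc (cong suc) (∈⇒∃emb U j∈U)
∈⇒∃emb (outside ∷ U) (there j∈U)   = Product.map id (cong suc) (∈⇒∃emb U j∈U)

emb-or-∉ : ∀ {n} (U : Subset n) j → (∃ λ i → emb U i ≡ j) ⊎ j ∉ U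
emb-or-∉ U j with j ∈? U
... | yes j∈U = inj₁ (∈⇒∃emb U j∈U)
... | no  j∉U = inj₂ j∉U

sumFin-over : ∀ {n} (U : Subset n) (f : Fin n → ℚ) → (∀ j → j ∉ U → f j ≡ 0ℚ) →
  sumFin f ≡ sumFin (f ∘ emb U)
sumFin-over []            f f≡0 = refl
sumFin-over (inside ∷ U)  f f≡0 = cong (f zero +_) (sumFin-over U (f ∘ suc) (λ j j∉U → f≡0 (suc j) (j∉U ∘ drop)))
  where drop : ∀ {j} → suc j ∈ inside ∷ U → j ∈ U
        drop (there j∈U) = j∈U
sumFin-over (outside ∷ U) f f≡0 = begin
  f zero + sumFin (f ∘ suc)   ≡⟨ cong (_+ sumFin (f ∘ suc)) (f≡0 zero (λ ())) ⟩
  0ℚ + sumFin (f ∘ suc)       ≡⟨ +-identityˡ _ ⟩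
  sumFin (f ∘ suc)            ≡⟨ sumFin-over U (f ∘ suc) (λ j j∉U → f≡0 (suc j) (j∉U ∘ drop)) ⟩
  sumFin (f ∘ suc ∘ emb U)    ∎
  where drop : ∀ {j} → suc j ∈ outside ∷ U → j ∈ U
        drop (there j∈U) = j∈U

extend : ∀ {n} (U : Subset n) → Point (card U) → Point n
extend (inside ∷ U)  y zero    = y zero
extend (inside ∷ U)  y (suc j) = extend U (y ∘ suc) j
extend (outside ∷ U) y zero    = 0ℚ
extend (outside ∷ U) y (suc j) = extend U y j

extend-emb : ∀ {n} (U : Subset n) y i → extend U y (emb U i) ≡ y i
extend-emb (inside ∷ U)  y zero    = refl
extend-emb (inside ∷ U)  y (suc i) = extend-emb U (y ∘ suc) i
extend-emb (outside ∷ U) y i       = extend-emb U y i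

extend-∉ : ∀ {n} (U : Subset n) y j → j ∉ U → extend U y j ≡ 0ℚ
extend-∉ (inside ∷ U)  y zero    j∉U = ⊥-elim (j∉U here)
extend-∉ (outside ∷ U) y zero    j∉U = refl
extend-∉ (inside ∷ U)  y (suc j) j∉U = extend-∉ U (y ∘ suc) j (j∉U ∘ there)
extend-∉ (outside ∷ U) y (suc j) j∉U = extend-∉ U y j (j∉U ∘ there)

card+card-∁ : ∀ {n} (U : Subset n) → card U ℕ.+ card (∁ U) ≡ n
card+card-∁ []            = refl
card+card-∁ (inside ∷ U)  = cong suc (card+card-∁ U)
card+card-∁ (outside ∷ U) = trans (ℕₚ.+-suc (card U) (card (∁ U))) (cong suc (card+card-∁ U))

emb-or-emb-∁ : ∀ {n} (U : Subset n) j → (∃ λ t → emb U t ≡ j) ⊎ (∃ λ l → emb (∁ U) l ≡ j)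
emb-or-emb-∁ U j with j ∈? U
... | yes j∈U = inj₁ (∈⇒∃emb U j∈U)
... | no  j∉U = inj₂ (∈⇒∃emb (∁ U) (x∉p⇒x∈∁p j∉U))

emb≢emb-∁ : ∀ {n} (U : Subset n) t l → emb U t ≢ emb (∁ U) l
emb≢emb-∁ U t l eq = x∈p⇒x∉∁p (emb-∈ U t) (subst (_∈ ∁ U) (sym eq) (emb-∈ (∁ U) l))

∈supp⇒≢0 : ∀ {n} (a : Point n) {j} → j ∈ supp a → a j ≢ 0ℚ
∈supp⇒≢0 a {j} j∈supp = side-inside⇒≢0 (a j) (trans (sym (lookup∘tabulate (side ∘ a) j)) ([]=⇒lookup j∈supp))
  where
  side-inside⇒≢0 : ∀ q → side q ≡ inside → q ≢ 0ℚ
  side-inside⇒≢0 q side≡inside with q ≟ 0ℚ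
  side-inside⇒≢0 q () | yes _
  ... | no q≢0 = q≢0

≢0⇒∈supp : ∀ {n} (a : Point n) {j} → a j ≢ 0ℚ → j ∈ supp a
≢0⇒∈supp a {j} aj≢0 = lookup⇒[]= j (supp a) (trans (lookup∘tabulate (side ∘ a) j) (≢0⇒side-inside (a j) aj≢0))
  where
  ≢0⇒side-inside : ∀ q → q ≢ 0ℚ → side q ≡ inside
  ≢0⇒side-inside q q≢0 with q ≟ 0ℚ
  ... | yes q≡0 = ⊥-elim (q≢0 q≡0)
  ... | no  _   = refl

∉supp⇒≡0 : ∀ {n} (a : Point n) {j} → j ∉ supp a → a j ≡ 0ℚ
∉supp⇒≡0 a {j} j∉supp with a j ≟ 0ℚ
... | yes aj≡0 = aj≡0
... | no  aj≢0 = ⊥-elim (j∉supp (≢0⇒∈supp a aj≢0))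

restrict-≢0 : ∀ {n} (a : Point n) i → restrict a i ≢ 0ℚ
restrict-≢0 a i = ∈supp⇒≢0 a (emb-∈ (supp a) i)

dot-restrict : ∀ {n} (a x : Point n) → dot a x ≡ dot (restrict a) (x ∘ emb (supp a))
dot-restrict a x = sumFin-over (supp a) (λ j → a j * x j)
  (λ j j∉supp → trans (cong (_* x j) (∉supp⇒≡0 a j∉supp)) (*-zeroˡ (x j)))

dot-extend : ∀ {n} (a : Point n) y → dot a (extend (supp a) y) ≡ dot (restrict a) y
dot-extend a y = trans (dot-restrict a (extend (supp a) y)) (dot-cong (restrict a) (extend-emb (supp a) y))

-- Stable set polytopes

chi-cong : ∀ {n m} (S : Subset n) (S′ : Subset m) {v w} → lookup S v ≡ lookup S′ w → chi S v ≡ chi S′ w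
chi-cong S S′ {v} {w} eq with lookup S v | lookup S′ w
chi-cong S S′ refl | true  | .true  = refl
chi-cong S S′ refl | false | .false = refl

chi-∈ : ∀ {n} {S : Subset n} {v} → v ∈ S → chi S v ≡ 1ℚ
chi-∈ {S = S} {v} v∈S with lookup S v | []=⇒lookup v∈S
... | .true | refl = refl

chi-∉ : ∀ {n} {S : Subset n} {v} → v ∉ S → chi S v ≡ 0ℚ
chi-∉ {S = S} {v} v∉S with lookup S v in eq
... | true  = ⊥-elim (v∉S (lookup⇒[]= v S eq))
... | false = refl

chi-Is01 : ∀ {n} (S : Subset n) v → Is01 (chi S v)
chi-Is01 S v with lookup S v
... | true  = inj₂ refl
... | false = inj₁ refl

Is01⇒bounds : ∀ {q} → Is01 q → (0ℚ ≤ q) × (q ≤ 1ℚ)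
Is01⇒bounds (inj₁ refl) = ≤-refl , 0≤1
Is01⇒bounds (inj₂ refl) = 0≤1 , ≤-refl

-- Pstab G unfolds to Conv (StablePoint G).
StablePoint : ∀ {n} → Graph n → Poly n
StablePoint G x = Σ _ λ S → IsStable G S × (∀ j → x j ≡ chi S j)

StablePoint-Is01 : ∀ {n} (G : Graph n) {x} → StablePoint G x → ∀ j → Is01 (x j)
StablePoint-Is01 G (S , _ , x≡χS) j = subst Is01 (sym (x≡χS j)) (chi-Is01 S j)

StablePoint-edge : ∀ {n} (G : Graph n) {x} → StablePoint G x → ∀ v w → Edge G v w → x v + x w ≤ 1ℚ
StablePoint-edge G {x} x∈S@(S , stable , x≡χS) v w vw with v ∈? S | w ∈? S
... | yes v∈S | yes w∈S with trans (sym vw) (stable v w v∈S w∈S)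
...   | ()
StablePoint-edge G {x} x∈S@(S , stable , x≡χS) v w vw | no v∉S | _ =
  subst (_≤ 1ℚ) (cong (_+ x w) (sym (trans (x≡χS v) (chi-∉ v∉S))))
    (subst (_≤ 1ℚ) (sym (+-identityˡ (x w))) (proj₂ (Is01⇒bounds (StablePoint-Is01 G x∈S w))))
StablePoint-edge G {x} x∈S@(S , stable , x≡χS) v w vw | yes _ | no w∉S =
  subst (_≤ 1ℚ) (cong (x v +_) (sym (trans (x≡χS w) (chi-∉ w∉S))))
    (subst (_≤ 1ℚ) (sym (+-identityʳ (x v))) (proj₂ (Is01⇒bounds (StablePoint-Is01 G x∈S v))))

Conv-single : ∀ {n} {S : Poly n} {x} → S x → Conv S x
Conv-single {x = x} x∈S = 1 , (λ _ → x) , (λ _ → 1ℚ) , (λ _ → x∈S) , (λ _ → 0≤1) , refl ,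
  λ j → sym (trans (+-identityʳ _) (*-identityˡ (x j)))

Conv-∘ : ∀ {n m} {S : Poly n} {S′ : Poly m} (e : Fin m → Fin n) →
  (∀ p → S p → S′ (p ∘ e)) → ∀ x → Conv S x → Conv S′ (x ∘ e)
Conv-∘ e S→S′ x (k , p , μ , p∈S , μ≥0 , Σμ≡1 , x≡μp) =
  k , (λ i → p i ∘ e) , μ , (λ i → S→S′ (p i) (p∈S i)) , μ≥0 , Σμ≡1 , x≡μp ∘ e

Conv-extend : ∀ {n} (U : Subset n) {S : Poly (card U)} {S′ : Poly n} →
  (∀ p → S p → S′ (extend U p)) → ∀ x → Conv S x → Conv S′ (extend U x)
Conv-extend U S→S′ x (k , p , μ , p∈S , μ≥0 , Σμ≡1 , x≡μp) =
  k , (λ i → extend U (p i)) , μ , (λ i → S→S′ (p i) (p∈S i)) , μ≥0 , Σμ≡1 , ext≡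
  where
  ext≡ : ∀ j → extend U x j ≡ lincomb μ (λ i → extend U (p i)) j
  ext≡ j with emb-or-∉ U j
  ... | inj₁ (t , refl) = begin
    extend U x (emb U t)                          ≡⟨ extend-emb U x t ⟩
    x t                                           ≡⟨ x≡μp t ⟩
    lincomb μ p t                                 ≡⟨ sumFin-cong (λ i → cong (μ i *_) (extend-emb U (p i) t)) ⟨
    lincomb μ (λ i → extend U (p i)) (emb U t)    ∎
  ... | inj₂ j∉U = trans (extend-∉ U x j j∉U)
    (sym (lincomb-zeroʳ μ (λ i → extend U (p i)) j (λ i → extend-∉ U (p i) j j∉U)))

Conv-valid : ∀ {n} {S : Poly n} (c : Point n) (d : ℚ) → Valid S c d → Valid (Conv S) c d
Conv-valid c d valid x (k , p , μ , p∈S , μ≥0 , Σμ≡1 , x≡μp) =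
  subst (_≤ d) (sym (trans (dot-cong c x≡μp) (dot-lincomb c μ p)))
    (convexCombination-≤ μ (λ i → dot c (p i)) d μ≥0 Σμ≡1 (λ i → valid (p i) (p∈S i)))

lincomb-nonNeg : ∀ {k n} (μ : Fin k → ℚ) (p : Fin k → Point n) j → (∀ i → 0ℚ ≤ μ i) → (∀ i → 0ℚ ≤ p i j) →
  0ℚ ≤ lincomb μ p j
lincomb-nonNeg μ p j μ≥0 p≥0 = sumFin-nonNeg (λ i → μ i * p i j) (λ i → 0≤p*q (μ≥0 i) (p≥0 i))

Pstab⊆Redge : ∀ {n} (G : Graph n) x → Pstab G x → Redge G x
Pstab⊆Redge G x (k , p , μ , p∈S , μ≥0 , Σμ≡1 , x≡μp) = (λ v → x≥0 v , x≤1 v) , edge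
  where
  bounds : ∀ i v → (0ℚ ≤ p i v) × (p i v ≤ 1ℚ)
  bounds i v = Is01⇒bounds (StablePoint-Is01 G (p∈S i) v)
  x≥0 : ∀ v → 0ℚ ≤ x v
  x≥0 v = subst (0ℚ ≤_) (sym (x≡μp v)) (lincomb-nonNeg μ p v μ≥0 (λ i → proj₁ (bounds i v)))
  x≤1 : ∀ v → x v ≤ 1ℚ
  x≤1 v = subst (_≤ 1ℚ) (sym (x≡μp v)) (convexCombination-≤ μ (λ i → p i v) 1ℚ μ≥0 Σμ≡1 (λ i → proj₂ (bounds i v)))
  edge : ∀ v w → Edge G v w → x v + x w ≤ 1ℚ
  edge v w vw = subst (_≤ 1ℚ) (sym xv+xw≡) (convexCombination-≤ μ (λ i → p i v + p i w) 1ℚ μ≥0 Σμ≡1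
    (λ i → StablePoint-edge G (p∈S i) v w vw))
    where
    xv+xw≡ : x v + x w ≡ sumFin (λ i → μ i * (p i v + p i w))
    xv+xw≡ = begin
      x v + x w                                             ≡⟨ cong₂ _+_ (x≡μp v) (x≡μp w) ⟩
      lincomb μ p v + lincomb μ p w                         ≡⟨ sumFin-distrib-+ (λ i → μ i * p i v) (λ i → μ i * p i w) ⟨
      sumFin (λ i → μ i * p i v + μ i * p i w)              ≡⟨ sumFin-cong (λ i → *-distribˡ-+ (μ i) (p i v) (p i w)) ⟨
      sumFin (λ i → μ i * (p i v + p i w))                  ∎

StablePoint-pullback : ∀ {m n} (G : Graph m) (H : Graph n) (f : Fin m → Fin n) →
  (∀ u v → adj G u v ≡ adj H (f u) (f v)) → ∀ p → StablePoint H p → StablePoint G (p ∘ f)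
StablePoint-pullback G H f adj≡ p (S , stable , p≡χS) =
  tabulate (lookup S ∘ f) ,
  (λ u v u∈ v∈ → trans (adj≡ u v) (stable (f u) (f v) (∈-pullback u∈) (∈-pullback v∈))) ,
  λ j → trans (p≡χS (f j)) (chi-cong S (tabulate (lookup S ∘ f)) (sym (lookup∘tabulate (lookup S ∘ f) j)))
  where
  ∈-pullback : ∀ {u} → u ∈ tabulate (lookup S ∘ f) → f u ∈ S
  ∈-pullback {u} u∈ = lookup⇒[]= (f u) S (trans (sym (lookup∘tabulate (lookup S ∘ f) u)) ([]=⇒lookup u∈))

extendSubset : ∀ {n} (U : Subset n) → Subset (card U) → Subset n
extendSubset []            T       = []
extendSubset (inside ∷ U)  (t ∷ T) = t ∷ extendSubset U T
extendSubset (outside ∷ U) T       = outside ∷ extendSubset U T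

lookup-extendSubset : ∀ {n} (U : Subset n) T i → lookup (extendSubset U T) (emb U i) ≡ lookup T i
lookup-extendSubset (inside ∷ U)  (t ∷ T) zero    = refl
lookup-extendSubset (inside ∷ U)  (t ∷ T) (suc i) = lookup-extendSubset U T i
lookup-extendSubset (outside ∷ U) T       i       = lookup-extendSubset U T i

∈-extendSubset : ∀ {n} (U : Subset n) T {j} → j ∈ extendSubset U T → ∃ λ i → emb U i ≡ j × i ∈ T
∈-extendSubset (inside ∷ U)  (t ∷ T) here      = zero , refl , here
∈-extendSubset (inside ∷ U)  (t ∷ T) (there j∈) with ∈-extendSubset U T j∈
... | i , refl , i∈T = suc i , refl , there i∈T
∈-extendSubset (outside ∷ U) T       (there j∈) with ∈-extendSubset U T j∈
... | i , refl , i∈T = i , refl , i∈T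

StablePoint-extend : ∀ {n} (G : Graph n) (U : Subset n) y → StablePoint (induced G U) y → StablePoint G (extend U y)
StablePoint-extend G U y (T , stable , y≡χT) = extendSubset U T , stableᴳ , ext≡
  where
  stableᴳ : IsStable G (extendSubset U T)
  stableᴳ u v u∈ v∈ with ∈-extendSubset U T u∈ | ∈-extendSubset U T v∈
  ... | i , refl , i∈T | i′ , refl , i′∈T = stable i i′ i∈T i′∈T
  ext≡ : ∀ j → extend U y j ≡ chi (extendSubset U T) j
  ext≡ j with emb-or-∉ U j
  ... | inj₁ (t , refl) = trans (extend-emb U y t)
    (trans (y≡χT t) (chi-cong T (extendSubset U T) (sym (lookup-extendSubset U T t))))
  ... | inj₂ j∉U = trans (extend-∉ U y j j∉U) (sym (chi-∉ j∉ext))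
    where
    j∉ext : j ∉ extendSubset U T
    j∉ext j∈ with ∈-extendSubset U T j∈
    ... | i , refl , _ = j∉U (emb-∈ U i)

Pstab-restrict : ∀ {n} (G : Graph n) (U : Subset n) x → Pstab G x → Pstab (induced G U) (x ∘ emb U)
Pstab-restrict G U = Conv-∘ {S = StablePoint G} {S′ = StablePoint (induced G U)} (emb U)
  (StablePoint-pullback (induced G U) G (emb U) (λ _ _ → refl))

Pstab-extend : ∀ {n} (G : Graph n) (U : Subset n) y → Pstab (induced G U) y → Pstab G (extend U y)
Pstab-extend G U = Conv-extend U {S = StablePoint (induced G U)} {S′ = StablePoint G} (StablePoint-extend G U)

unitPoint : ∀ {n} → Fin (suc n) → Point n
unitPoint zero    = chi ∅
unitPoint (suc i) = chi ⁅ i ⁆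

unitPoint-stable : ∀ {n} (G : Graph n) i → StablePoint G (unitPoint i)
unitPoint-stable G zero    = ∅ , (λ u v u∈∅ → ⊥-elim (∉⊥ u∈∅)) , λ _ → refl
unitPoint-stable G (suc i) = ⁅ i ⁆ , stable , λ _ → refl
  where
  stable : IsStable G ⁅ i ⁆
  stable u v u∈ v∈ with x∈⁅y⁆⇒x≡y i u∈ | x∈⁅y⁆⇒x≡y i v∈
  ... | refl | refl = adj-irr G i

lincomb-unitPoint : ∀ {n} (μ : Fin (suc n) → ℚ) j → lincomb μ unitPoint j ≡ μ (suc j)
lincomb-unitPoint {n} μ j = begin
  μ zero * chi ∅ j + rest    ≡⟨ cong (λ z → μ zero * z + rest) (chi-∉ {n} {∅} {j} ∉⊥) ⟩
  μ zero * 0ℚ + rest         ≡⟨ cong (_+ rest) (*-zeroʳ (μ zero)) ⟩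
  0ℚ + rest                  ≡⟨ +-identityˡ rest ⟩
  rest                       ≡⟨ sumFin-single j (λ t → μ (suc t) * chi ⁅ t ⁆ j) others≡0 ⟩
  μ (suc j) * chi ⁅ j ⁆ j    ≡⟨ cong (μ (suc j) *_) (chi-∈ (x∈⁅x⁆ j)) ⟩
  μ (suc j) * 1ℚ             ≡⟨ *-identityʳ (μ (suc j)) ⟩
  μ (suc j)                  ∎
  where
  rest = sumFin (λ t → μ (suc t) * chi ⁅ t ⁆ j)
  others≡0 : ∀ t → t ≢ j → μ (suc t) * chi ⁅ t ⁆ j ≡ 0ℚ
  others≡0 t t≢j = trans (cong (μ (suc t) *_) (chi-∉ (x≢y⇒x∉⁅y⁆ (t≢j ∘ sym)))) (*-zeroʳ (μ (suc t)))

unitPoint-affIndep : ∀ {n} → AffIndep (unitPoint {n})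
unitPoint-affIndep {n} μ Σμ≡0 μe≡0 = μ≡0
  where
  μ≡0 : ∀ i → μ i ≡ 0ℚ
  μ≡0 (suc j) = trans (sym (lincomb-unitPoint μ j)) (μe≡0 j)
  μ≡0 zero    = begin
    μ zero                                 ≡⟨ +-identityʳ (μ zero) ⟨
    μ zero + 0ℚ                            ≡⟨ cong (μ zero +_) (trans (sumFin-cong (μ≡0 ∘ suc)) (sumFin-zero n)) ⟨
    μ zero + sumFin (μ ∘ suc)              ≡⟨ Σμ≡0 ⟩
    0ℚ                                     ∎

simplex⊆Pstab : ∀ {n} (G : Graph n) y → (∀ j → 0ℚ ≤ y j) → sumFin y ≤ 1ℚ → Pstab G y
simplex⊆Pstab {n} G y y≥0 Σy≤1 =
  suc n , unitPoint , μ , (unitPoint-stable G) , μ≥0 , Σμ≡1 , λ j → sym (lincomb-unitPoint μ j)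
  where
  μ : Fin (suc n) → ℚ
  μ = (1ℚ - sumFin y) Vector.∷ y
  μ≥0 : ∀ i → 0ℚ ≤ μ i
  μ≥0 zero    = p≤q⇒0≤q-p Σy≤1
  μ≥0 (suc j) = y≥0 j
  Σμ≡1 : sumFin μ ≡ 1ℚ
  Σμ≡1 = solve 1 (λ s → (con 1ℚ :- s) :+ s := con 1ℚ) refl (sumFin y)

Pstab-full : ∀ {n} (G : Graph n) → HasAffIndep (Pstab G) (suc n)
Pstab-full G = unitPoint , (λ i → Conv-single {S = StablePoint G} (unitPoint-stable G i)) , unitPoint-affIndep

lincomb-units-∉ : ∀ {c m} (e : Fin c → Fin m) (β : Fin c → ℚ) j → (∀ l → e l ≢ j) →
  lincomb β (λ l → chi ⁅ e l ⁆) j ≡ 0ℚ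
lincomb-units-∉ e β j e≢j = lincomb-zeroʳ β (λ l → chi ⁅ e l ⁆) j (λ l → chi-∉ (x≢y⇒x∉⁅y⁆ (e≢j l ∘ sym)))

lincomb-units-∈ : ∀ {c m} (e : Fin c → Fin m) (β : Fin c → ℚ) → (∀ {l l′} → e l ≡ e l′ → l ≡ l′) →
  ∀ l₀ → lincomb β (λ l → chi ⁅ e l ⁆) (e l₀) ≡ β l₀
lincomb-units-∈ e β e-injective l₀ = begin
  lincomb β (λ l → chi ⁅ e l ⁆) (e l₀)  ≡⟨ sumFin-single l₀ (λ l → β l * chi ⁅ e l ⁆ (e l₀)) others≡0 ⟩
  β l₀ * chi ⁅ e l₀ ⁆ (e l₀)             ≡⟨ cong (β l₀ *_) (chi-∈ (x∈⁅x⁆ (e l₀))) ⟩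
  β l₀ * 1ℚ                             ≡⟨ *-identityʳ (β l₀) ⟩
  β l₀                                  ∎
  where
  others≡0 : ∀ l → l ≢ l₀ → β l * chi ⁅ e l ⁆ (e l₀) ≡ 0ℚ
  others≡0 l l≢l₀ = trans (cong (β l *_) (chi-∉ (x≢y⇒x∉⁅y⁆ (l≢l₀ ∘ sym ∘ e-injective)))) (*-zeroʳ (β l))

complementUnits : ∀ {n} (U : Subset n) → Fin (card (∁ U)) → Fin (suc n) → ℚ
complementUnits U l = chi ⁅ suc (emb (∁ U) l) ⁆

-- The coordinates outside U are supplied by the unit vectors of ∁ U.
InSpan-unrestrict : ∀ {n s} (U : Subset n) (w : Fin s → Point n) (x : Point n) →
  InSpan (λ l → homogenize (w l ∘ emb U)) (homogenize (x ∘ emb U)) →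
  InSpan ((homogenize ∘ w) ++ complementUnits U) (homogenize x)
InSpan-unrestrict U w x (c , x≡cw) = c ++ β , λ j → trans (x≡F+E j) (sym (lincomb-++ c β (homogenize ∘ w) (complementUnits U) j))
  where
  F = lincomb c (homogenize ∘ w)
  β : Fin (card (∁ U)) → ℚ
  β l = x (emb (∁ U) l) - F (suc (emb (∁ U) l))
  E = lincomb β (complementUnits U)
  x≡F+E : ∀ j → homogenize x j ≡ F j + E j
  x≡F+E zero = begin
    1ℚ             ≡⟨ x≡cw zero ⟩
    F zero         ≡⟨ +-identityʳ (F zero) ⟨
    F zero + 0ℚ    ≡⟨ cong (F zero +_) (lincomb-units-∉ (suc ∘ emb (∁ U)) β zero (λ l ())) ⟨
    F zero + E zero ∎
  x≡F+E (suc v) with emb-or-emb-∁ U v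
  ... | inj₁ (t , refl) = begin
    x (emb U t)                        ≡⟨ x≡cw (suc t) ⟩
    F (suc (emb U t))                  ≡⟨ +-identityʳ _ ⟨
    F (suc (emb U t)) + 0ℚ             ≡⟨ cong (F (suc (emb U t)) +_) (lincomb-units-∉ (suc ∘ emb (∁ U)) β _
                                            (λ l eq → emb≢emb-∁ U t l (sym (Fin.suc-injective eq)))) ⟨
    F (suc (emb U t)) + E (suc (emb U t)) ∎
  ... | inj₂ (l₀ , refl) = begin
    x (emb (∁ U) l₀)                         ≡⟨ solve 2 (λ x f → x := f :+ (x :- f)) refl (x (emb (∁ U) l₀)) (F (suc (emb (∁ U) l₀))) ⟩
    F (suc (emb (∁ U) l₀)) + β l₀            ≡⟨ cong (F (suc (emb (∁ U) l₀)) +_) (lincomb-units-∈ (suc ∘ emb (∁ U)) β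
                                                  (emb-injective (∁ U) ∘ Fin.suc-injective) l₀) ⟨
    F (suc (emb (∁ U) l₀)) + E (suc (emb (∁ U) l₀)) ∎

HasAffIndep-restrict : ∀ {n} k (U : Subset n) {F : Poly n} {F′ : Poly (card U)} →
  (∀ x → F x → F′ (x ∘ emb U)) → HasAffIndep F (card (∁ U) ℕ.+ k) → HasAffIndep F′ k
HasAffIndep-restrict k U {F′ = F′} F→F′ (q , q∈F , indep)
  with spanningIndependentSubfamily (λ i → homogenize (q i ∘ emb U))
... | s , σ , indepσ , spans with k ℕ.≤? s
...   | yes k≤s = HasAffIndep-mono F′ k≤s
  ((λ l → q (σ l) ∘ emb U) , (λ l → F→F′ (q (σ l)) (q∈F (σ l))) , independent⇒affIndep (λ l → q (σ l) ∘ emb U) indepσ)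
...   | no  k≰s = ⊥-elim (ℕₚ.<⇒≱ s+c<c+k c+k≤s+c)
  where
  c = card (∁ U)
  c+k≤s+c : c ℕ.+ k ℕ.≤ s ℕ.+ c
  c+k≤s+c = independent-in-span⇒≤ ((homogenize ∘ q ∘ σ) ++ complementUnits U) (homogenize ∘ q)
    (λ i → InSpan-unrestrict U (q ∘ σ) (q i) (spans i)) (affIndep⇒independent q indep)
  s+c<c+k : s ℕ.+ c ℕ.< c ℕ.+ k
  s+c<c+k = subst (ℕ._< c ℕ.+ k) (ℕₚ.+-comm c s) (ℕₚ.+-monoʳ-< c (ℕₚ.≰⇒> k≰s))

facetDefining-restrict : ∀ {n} (G : Graph n) (R : Poly n) a b →
  (∀ x → Pstab G x → R x) → (∀ x → R x → Pstab (induced G (supp a)) (x ∘ emb (supp a))) →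
  FacetDefining R a b → FacetDefining (Pstab (induced G (supp a))) (restrict a) b
facetDefining-restrict G R a b Pstab⊆R R→PU facet =
  facetDefining-intro PU (restrict a) b (Pstab-full (induced G U)) valid nonzero faceᵁ
  where
  U = supp a
  PU = Pstab (induced G U)
  valid : Valid PU (restrict a) b
  valid y y∈PU = subst (_≤ b) (dot-extend a y) (proj₁ facet (extend U y) (Pstab⊆R _ (Pstab-extend G U y y∈PU)))
  nonzero : ∃ λ t → restrict a t ≢ 0ℚ
  nonzero with facetDefining⇒nonzero R a b facet
  ... | i , ai≢0 with ∈⇒∃emb U (≢0⇒∈supp a ai≢0)
  ...   | t , _ = t , restrict-≢0 a t
  faceᴿ : HasAffIndep (Face R a b) (card (∁ U) ℕ.+ card U)
  faceᴿ = subst (HasAffIndep (Face R a b)) (trans (sym (card+card-∁ U)) (ℕₚ.+-comm (card U) (card (∁ U))))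
    (full-facetDefining⇒face-dim R a b (HasAffIndep-⊆ Pstab⊆R (Pstab-full G)) facet)
  faceᵁ : HasAffIndep (Face PU (restrict a) b) (card U)
  faceᵁ = HasAffIndep-restrict (card U) U {Face R a b} {Face PU (restrict a) b}
    (λ x (x∈R , ax≡b) → R→PU x x∈R , trans (sym (dot-restrict a x)) ax≡b) faceᴿ

nonNeg-terms-sumFin≡0 : ∀ {k} (μ g : Fin k → ℚ) → (∀ i → 0ℚ ≤ μ i) → (∀ i → 0ℚ ≤ g i) →
  sumFin (λ i → μ i * g i) ≡ 0ℚ → ∀ i → μ i ≢ 0ℚ → g i ≡ 0ℚ
nonNeg-terms-sumFin≡0 μ g μ≥0 g≥0 Σ≡0 i μi≢0 =
  p≢0∧p*q≡0⇒q≡0 μi≢0 (nonNeg-sumFin≡0⇒≡0 (λ i → μ i * g i) (λ i → 0≤p*q (μ≥0 i) (g≥0 i)) Σ≡0 i)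

convexCombination-≡max : ∀ {k} (μ f : Fin k → ℚ) (d : ℚ) → (∀ i → 0ℚ ≤ μ i) → sumFin μ ≡ 1ℚ →
  (∀ i → f i ≤ d) → sumFin (λ i → μ i * f i) ≡ d → ∀ i → μ i ≢ 0ℚ → f i ≡ d
convexCombination-≡max μ f d μ≥0 Σμ≡1 f≤d Σμf≡d i μi≢0 = sym (p-q≡0⇒p≡q
  (nonNeg-terms-sumFin≡0 μ (λ i → d - f i) μ≥0 (λ i → p≤q⇒0≤q-p (f≤d i)) gap≡0 i μi≢0))
  where
  gap≡0 : sumFin (λ i → μ i * (d - f i)) ≡ 0ℚ
  gap≡0 = begin
    sumFin (λ i → μ i * (d - f i))                     ≡⟨ sumFin-cong (λ i → *-distribˡ-- (μ i) d (f i)) ⟩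
    sumFin (λ i → μ i * d - μ i * f i)                 ≡⟨ sumFin-distrib-- (λ i → μ i * d) (λ i → μ i * f i) ⟩
    sumFin (λ i → μ i * d) - sumFin (λ i → μ i * f i)  ≡⟨ cong₂ _-_ (*-distribʳ-sumFin d μ) (sym Σμf≡d) ⟨
    sumFin μ * d - d                                   ≡⟨ cong (λ s → s * d - d) Σμ≡1 ⟩
    1ℚ * d - d                                         ≡⟨ solve 1 (λ d → con 1ℚ :* d :- d := con 0ℚ) refl d ⟩
    0ℚ                                                 ∎
    where
    *-distribˡ-- : ∀ x y z → x * (y - z) ≡ x * y - x * z
    *-distribˡ-- = solve 3 (λ x y z → x :* (y :- z) := x :* y :- x :* z) refl

arg-extremum : ∀ {m} {_≼_ : ℚ → ℚ → Set} →
  (∀ p q → (p ≼ q) ⊎ (q ≼ p)) → (∀ {p q r} → p ≼ q → q ≼ r → p ≼ r) →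
  (f : Fin (suc m) → ℚ) → ∃ λ k → ∀ k′ → f k′ ≼ f k
arg-extremum {zero}  total _     f = zero , λ { zero → [ id , id ]′ (total (f zero) (f zero)) }
arg-extremum {suc m} total trans f with arg-extremum total trans (f ∘ suc)
... | k , best with total (f zero) (f (suc k))
...   | inj₁ f₀≼ = suc k , λ { zero → f₀≼ ; (suc k′) → best k′ }
...   | inj₂ ≼f₀ = zero  , λ { zero → [ id , id ]′ (total (f zero) (f zero)) ; (suc k′) → trans (best k′) ≼f₀ }

argmax : ∀ {m} (f : Fin (suc m) → ℚ) → ∃ λ k → ∀ k′ → f k′ ≤ f k
argmax = arg-extremum ≤-total ≤-trans

argmin : ∀ {m} (f : Fin (suc m) → ℚ) → ∃ λ k → ∀ k′ → f k ≤ f k′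
argmin = arg-extremum (λ p q → ≤-total q p) (λ p≥q q≥r → ≤-trans q≥r p≥q)

lincomb-tight : ∀ {k n} (a : Point n) (b : ℚ) (μ : Fin k → ℚ) (p : Fin k → Point n) {x} →
  (∀ i → 0ℚ ≤ μ i) → sumFin μ ≡ 1ℚ → (∀ j → x j ≡ lincomb μ p j) →
  (∀ i → dot a (p i) ≤ b) → dot a x ≡ b → ∀ i → μ i ≢ 0ℚ → dot a (p i) ≡ b
lincomb-tight a b μ p {x} μ≥0 Σμ≡1 x≡μp p≤b ax≡b =
  convexCombination-≡max μ (λ i → dot a (p i)) b μ≥0 Σμ≡1 p≤b
    (trans (sym (dot-lincomb a μ p)) (trans (sym (dot-cong a x≡μp)) ax≡b))

homogenize-lincomb : ∀ {k n} (μ : Fin k → ℚ) (p : Fin k → Point n) {x} → sumFin μ ≡ 1ℚ →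
  (∀ j → x j ≡ lincomb μ p j) → ∀ j → homogenize x j ≡ lincomb μ (homogenize ∘ p) j
homogenize-lincomb μ p Σμ≡1 x≡μp zero    = sym (trans (lincomb-homogenize μ p) Σμ≡1)
homogenize-lincomb μ p Σμ≡1 x≡μp (suc j) = x≡μp j

InSpan-support : ∀ {k n} (U : Subset k) (v : Fin k → Fin n → ℚ) (μ : Fin k → ℚ) {y} →
  (∀ j → y j ≡ lincomb μ v j) → (∀ i → i ∉ U → μ i ≡ 0ℚ) → InSpan (v ∘ emb U) y
InSpan-support U v μ y≡μv μ≡0 = μ ∘ emb U , λ j → trans (y≡μv j)
  (sumFin-over U (λ i → μ i * v i j) (λ i i∉U → trans (cong (_* v i j) (μ≡0 i i∉U)) (*-zeroˡ (v i j))))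

-- The edge relaxation of the triangle

Complete : ∀ {n} → Graph n → Set
Complete G = ∀ u v → u ≢ v → Edge G u v

halfPoint : ∀ {n} → Point n
halfPoint _ = ½

halfPoint-Redge : ∀ {n} (G : Graph n) → Redge G halfPoint
halfPoint-Redge G = (λ _ → ≤ᵇ⇒≤ tt , ≤ᵇ⇒≤ tt) , λ _ _ _ → ≤ᵇ⇒≤ tt

-- Index 0 is (½,½,½), index 1 the origin and index 2 + j the unit vector e_j.
vertex : Fin 5 → Point 3
vertex = halfPoint Vector.∷ unitPoint

vertex-Redge : ∀ (G : Graph 3) i → Redge G (vertex i)
vertex-Redge G zero    = halfPoint-Redge G
vertex-Redge G (suc i) = Pstab⊆Redge G (unitPoint i) (Conv-single {S = StablePoint G} (unitPoint-stable G i))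

TriangleCombination : Point 3 → Set
TriangleCombination x = Σ (Fin 5 → ℚ) λ l → (∀ i → 0ℚ ≤ l i) × (sumFin l ≡ 1ℚ) × (∀ j → x j ≡ lincomb l vertex j)

-- With m a coordinate of minimal value: weight 2 x_m on (½,½,½) and x_j − x_m on e_j.
Redge-triangleCombination : ∀ (G : Graph 3) → Complete G → ∀ x → Redge G x → TriangleCombination x
Redge-triangleCombination G complete x (bounds , edge) = l , l≥0 , Σl≡1 , x≡
  where
  m = proj₁ (argmin x)
  x≥xₘ = proj₂ (argmin x)
  l : Fin 5 → ℚ
  l 0F              = x m + x m
  l 1F              = 1ℚ - (x 0F + x 1F + x 2F) + x m
  l (suc (suc j))   = x j - x m
  l₁≡ : ∀ m → ∃₂ λ u v → u ≢ v × 1ℚ - (x 0F + x 1F + x 2F) + x m ≡ 1ℚ - (x u + x v)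
  l₁≡ 0F = 1F , 2F , (λ ()) , solve 3 (λ a b c → con 1ℚ :- (a :+ b :+ c) :+ a := con 1ℚ :- (b :+ c)) refl (x 0F) (x 1F) (x 2F)
  l₁≡ 1F = 0F , 2F , (λ ()) , solve 3 (λ a b c → con 1ℚ :- (a :+ b :+ c) :+ b := con 1ℚ :- (a :+ c)) refl (x 0F) (x 1F) (x 2F)
  l₁≡ 2F = 0F , 1F , (λ ()) , solve 3 (λ a b c → con 1ℚ :- (a :+ b :+ c) :+ c := con 1ℚ :- (a :+ b)) refl (x 0F) (x 1F) (x 2F)
  l≥0 : ∀ i → 0ℚ ≤ l i
  l≥0 0F            = 0≤p+q (proj₁ (bounds m)) (proj₁ (bounds m))
  l≥0 1F with l₁≡ m
  ... | u , v , u≢v , eq = subst (0ℚ ≤_) (sym eq) (p≤q⇒0≤q-p (edge u v (complete u v u≢v)))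
  l≥0 (suc (suc j)) = p≤q⇒0≤q-p (x≥xₘ j)
  Σl≡1 : sumFin l ≡ 1ℚ
  Σl≡1 = solve 4 (λ a b c m → (m :+ m) :+ ((con 1ℚ :- (a :+ b :+ c) :+ m) :+ ((a :- m) :+ ((b :- m) :+ ((c :- m) :+ con 0ℚ))))
                               := con 1ℚ) refl (x 0F) (x 1F) (x 2F) (x m)
  x≡ : ∀ j → x j ≡ lincomb l vertex j
  x≡ 0F = solve 4 (λ a b c m → a := (m :+ m) :* con ½ :+ ((con 1ℚ :- (a :+ b :+ c) :+ m) :* con 0ℚ :+ ((a :- m) :* con 1ℚ
                     :+ ((b :- m) :* con 0ℚ :+ ((c :- m) :* con 0ℚ :+ con 0ℚ))))) refl (x 0F) (x 1F) (x 2F) (x m)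
  x≡ 1F = solve 4 (λ a b c m → b := (m :+ m) :* con ½ :+ ((con 1ℚ :- (a :+ b :+ c) :+ m) :* con 0ℚ :+ ((a :- m) :* con 0ℚ
                     :+ ((b :- m) :* con 1ℚ :+ ((c :- m) :* con 0ℚ :+ con 0ℚ))))) refl (x 0F) (x 1F) (x 2F) (x m)
  x≡ 2F = solve 4 (λ a b c m → c := (m :+ m) :* con ½ :+ ((con 1ℚ :- (a :+ b :+ c) :+ m) :* con 0ℚ :+ ((a :- m) :* con 0ℚ
                     :+ ((b :- m) :* con 0ℚ :+ ((c :- m) :* con 1ℚ :+ con 0ℚ))))) refl (x 0F) (x 1F) (x 2F) (x m)

¬1+1≤1 : ¬ (1ℚ + 1ℚ ≤ 1ℚ)
¬1+1≤1 = ≤⇒≤ᵇ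

Redge-complete-two-ones : ∀ {n} (G : Graph n) → Complete G → ∀ {y} → Redge G y →
  ∀ u v → u ≢ v → y u ≡ 1ℚ → y v ≡ 1ℚ → ⊥
Redge-complete-two-ones G complete (_ , edge) u v u≢v yu≡1 yv≡1 =
  ¬1+1≤1 (subst₂ (λ p q → p + q ≤ 1ℚ) yu≡1 yv≡1 (edge u v (complete u v u≢v)))

Redge-integral : ∀ (G : Graph 3) → Complete G → ∀ y → Redge G y → (∀ j → Is01 (y j)) →
  ∃ λ i → ∀ j → y j ≡ unitPoint i j
Redge-integral G complete y y∈R y01 with y01 0F | y01 1F | y01 2F
... | inj₂ y₀≡1 | inj₂ y₁≡1 | _         = ⊥-elim (Redge-complete-two-ones G complete y∈R 0F 1F (λ ()) y₀≡1 y₁≡1)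
... | inj₂ y₀≡1 | _         | inj₂ y₂≡1 = ⊥-elim (Redge-complete-two-ones G complete y∈R 0F 2F (λ ()) y₀≡1 y₂≡1)
... | _         | inj₂ y₁≡1 | inj₂ y₂≡1 = ⊥-elim (Redge-complete-two-ones G complete y∈R 1F 2F (λ ()) y₁≡1 y₂≡1)
... | inj₁ y₀ | inj₁ y₁ | inj₁ y₂ = 0F , λ { 0F → y₀ ; 1F → y₁ ; 2F → y₂ }
... | inj₂ y₀ | inj₁ y₁ | inj₁ y₂ = 1F , λ { 0F → y₀ ; 1F → y₁ ; 2F → y₂ }
... | inj₁ y₀ | inj₂ y₁ | inj₁ y₂ = 2F , λ { 0F → y₀ ; 1F → y₁ ; 2F → y₂ }
... | inj₁ y₀ | inj₁ y₁ | inj₂ y₂ = 3F , λ { 0F → y₀ ; 1F → y₁ ; 2F → y₂ }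

dot-chi-∅ : ∀ {n} (a : Point n) → dot a (chi ∅) ≡ 0ℚ
dot-chi-∅ {n} a = dot-zeroʳ a (chi ∅) (λ j → chi-∉ {n} {∅} {j} ∉⊥)

dot-chi-⁅⁆ : ∀ {n} (a : Point n) j → dot a (chi ⁅ j ⁆) ≡ a j
dot-chi-⁅⁆ a j = begin
  dot a (chi ⁅ j ⁆)     ≡⟨ sumFin-single j (λ t → a t * chi ⁅ j ⁆ t) others≡0 ⟩
  a j * chi ⁅ j ⁆ j     ≡⟨ cong (a j *_) (chi-∈ (x∈⁅x⁆ j)) ⟩
  a j * 1ℚ              ≡⟨ *-identityʳ (a j) ⟩
  a j                   ∎
  where
  others≡0 : ∀ t → t ≢ j → a t * chi ⁅ j ⁆ t ≡ 0ℚ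
  others≡0 t t≢j = trans (cong (a t *_) (chi-∉ (x≢y⇒x∉⁅y⁆ t≢j))) (*-zeroʳ (a t))

dot-halfPoint : ∀ (a : Point 3) → dot a halfPoint ≡ (a 0F + a 1F + a 2F) * ½
dot-halfPoint a = solve 3 (λ x y z → x :* con ½ :+ (y :* con ½ :+ (z :* con ½ :+ con 0ℚ)) := (x :+ y :+ z) :* con ½)
  refl (a 0F) (a 1F) (a 2F)

½[x+y+z]≡b⇒z≡0 : ∀ {b} x y z → (x + y + z) * ½ ≡ b → x ≡ b → y ≡ b → z ≡ 0ℚ
½[x+y+z]≡b⇒z≡0 {b} x y z sum≡b x≡b y≡b = begin
  z                                           ≡⟨ solve 3 (λ x y z → z := ((x :+ y :+ z) :* con ½ :+ (x :+ y :+ z) :* con ½) :- x :- y) refl x y z ⟩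
  ((x + y + z) * ½ + (x + y + z) * ½) - x - y ≡⟨ cong (λ s → (s + s) - x - y) sum≡b ⟩
  (b + b) - x - y                             ≡⟨ cong₂ (λ p q → (b + b) - p - q) x≡b y≡b ⟩
  (b + b) - b - b                             ≡⟨ solve 1 (λ b → (b :+ b) :- b :- b := con 0ℚ) refl b ⟩
  0ℚ                                          ∎

½[x+y+z]≤b⇒b≤0 : ∀ {b} x y z → (x + y + z) * ½ ≤ b → x ≡ b → y ≡ b → z ≡ b → b ≤ 0ℚ
½[x+y+z]≤b⇒b≤0 {b} x y z sum≤b refl refl refl = 0≤q-p⇒p≤q (subst (0ℚ ≤_) gap+gap≡-b (0≤p+q 0≤gap 0≤gap))
  where
  0≤gap : 0ℚ ≤ b - (b + b + b) * ½
  0≤gap = p≤q⇒0≤q-p sum≤b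
  gap+gap≡-b : (b - (b + b + b) * ½) + (b - (b + b + b) * ½) ≡ 0ℚ - b
  gap+gap≡-b = solve 1 (λ b → (b :- (b :+ b :+ b) :* con ½) :+ (b :- (b :+ b :+ b) :* con ½) := con 0ℚ :- b) refl b

Tight : Point 3 → ℚ → Fin 5 → Set
Tight a b i = dot a (vertex i) ≡ b

-- A tight origin forces b = 0, so no unit vector is tight; (½,½,½) and two tight unit
-- vectors force the third coefficient to vanish; three tight unit vectors force b = 0.
tightVertices≤2 : ∀ (a : Point 3) b → (∀ j → a j ≢ 0ℚ) → dot a halfPoint ≤ b → 0ℚ ≤ b →
  ∃ λ (T : Subset 5) → card T ℕ.≤ 2 × (∀ i → Tight a b i → i ∈ T)
tightVertices≤2 a b a≢0 half≤b 0≤b =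
  T , count (tight? 0F) (tight? 1F) (tight? 2F) (tight? 3F) (tight? 4F) , tight⇒∈T
  where
  tight? : ∀ i → Dec (Tight a b i)
  tight? i = dot a (vertex i) ≟ b
  T : Subset 5
  T = tabulate (does ∘ tight?)
  tight⇒∈T : ∀ i → Tight a b i → i ∈ T
  tight⇒∈T i tight = lookup⇒[]= i T (trans (lookup∘tabulate (does ∘ tight?) i) (dec-true (tight? i) tight))
  unit : ∀ j → Tight a b (suc (suc j)) → a j ≡ b
  unit j tight = trans (sym (dot-chi-⁅⁆ a j)) tight
  origin-unit : ∀ j → Tight a b 1F → Tight a b (suc (suc j)) → ⊥
  origin-unit j origin tight = a≢0 j (trans (unit j tight) (trans (sym origin) (dot-chi-∅ a)))
  half : Tight a b 0F → (a 0F + a 1F + a 2F) * ½ ≡ b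
  half tight = trans (sym (dot-halfPoint a)) tight
  half-sum-comm : ∀ x y z → (x + y + z) * ½ ≡ (x + z + y) * ½
  half-sum-comm = solve 3 (λ x y z → (x :+ y :+ z) :* con ½ := (x :+ z :+ y) :* con ½) refl
  half-sum-rotate : ∀ x y z → (x + y + z) * ½ ≡ (y + z + x) * ½
  half-sum-rotate = solve 3 (λ x y z → (x :+ y :+ z) :* con ½ := (y :+ z :+ x) :* con ½) refl
  three-units : Tight a b 2F → Tight a b 3F → Tight a b 4F → ⊥
  three-units t₀ t₁ t₂ = a≢0 0F (trans (unit 0F t₀) (≤-antisym
    (½[x+y+z]≤b⇒b≤0 (a 0F) (a 1F) (a 2F) (subst (_≤ b) (dot-halfPoint a) half≤b) (unit 0F t₀) (unit 1F t₁) (unit 2F t₂)) 0≤b))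
  count : (h : Dec (Tight a b 0F)) (o : Dec (Tight a b 1F))
          (t₀ : Dec (Tight a b 2F)) (t₁ : Dec (Tight a b 3F)) (t₂ : Dec (Tight a b 4F)) →
    card (does h ∷ does o ∷ does t₀ ∷ does t₁ ∷ does t₂ ∷ []) ℕ.≤ 2
  count _       (yes o) (yes t) _       _       = ⊥-elim (origin-unit 0F o t)
  count _       (yes o) _       (yes t) _       = ⊥-elim (origin-unit 1F o t)
  count _       (yes o) _       _       (yes t) = ⊥-elim (origin-unit 2F o t)
  count (yes _) (yes _) (no _)  (no _)  (no _)  = ℕₚ.≤ᵇ⇒≤ 2 2 tt
  count (no _)  (yes _) (no _)  (no _)  (no _)  = ℕₚ.≤ᵇ⇒≤ 1 2 tt
  count (yes h) (no _)  (yes t₀) (yes t₁) _     =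
    ⊥-elim (a≢0 2F (½[x+y+z]≡b⇒z≡0 (a 0F) (a 1F) (a 2F) (half h) (unit 0F t₀) (unit 1F t₁)))
  count (yes h) (no _)  (yes t₀) _       (yes t₂) =
    ⊥-elim (a≢0 1F (½[x+y+z]≡b⇒z≡0 (a 0F) (a 2F) (a 1F) (trans (sym (half-sum-comm (a 0F) (a 1F) (a 2F))) (half h)) (unit 0F t₀) (unit 2F t₂)))
  count (yes h) (no _)  _       (yes t₁) (yes t₂) =
    ⊥-elim (a≢0 0F (½[x+y+z]≡b⇒z≡0 (a 1F) (a 2F) (a 0F) (trans (sym (half-sum-rotate (a 0F) (a 1F) (a 2F))) (half h)) (unit 1F t₁) (unit 2F t₂)))
  count (yes _) (no _)  (yes _) (no _)  (no _)  = ℕₚ.≤ᵇ⇒≤ 2 2 tt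
  count (yes _) (no _)  (no _)  (yes _) (no _)  = ℕₚ.≤ᵇ⇒≤ 2 2 tt
  count (yes _) (no _)  (no _)  (no _)  (yes _) = ℕₚ.≤ᵇ⇒≤ 2 2 tt
  count (yes _) (no _)  (no _)  (no _)  (no _)  = ℕₚ.≤ᵇ⇒≤ 1 2 tt
  count (no _)  (no _)  (yes t₀) (yes t₁) (yes t₂) = ⊥-elim (three-units t₀ t₁ t₂)
  count (no _)  (no _)  (yes _) (yes _) (no _)  = ℕₚ.≤ᵇ⇒≤ 2 2 tt
  count (no _)  (no _)  (yes _) (no _)  (yes _) = ℕₚ.≤ᵇ⇒≤ 2 2 tt
  count (no _)  (no _)  (no _)  (yes _) (yes _) = ℕₚ.≤ᵇ⇒≤ 2 2 tt
  count (no _)  (no _)  (yes _) (no _)  (no _)  = ℕₚ.≤ᵇ⇒≤ 1 2 tt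
  count (no _)  (no _)  (no _)  (yes _) (no _)  = ℕₚ.≤ᵇ⇒≤ 1 2 tt
  count (no _)  (no _)  (no _)  (no _)  (yes _) = ℕₚ.≤ᵇ⇒≤ 1 2 tt
  count (no _)  (no _)  (no _)  (no _)  (no _)  = ℕₚ.≤ᵇ⇒≤ 0 2 tt

tightCombination-inSpan : ∀ (G : Graph 3) → Complete G → ∀ a b → Valid (Redge G) a b →
  (T : Subset 5) → (∀ i → Tight a b i → i ∈ T) →
  ∀ x → Redge G x → dot a x ≡ b → InSpan ((homogenize ∘ vertex) ∘ emb T) (homogenize x)
tightCombination-inSpan G complete a b valid T tight⇒∈T x x∈R ax≡b = spans (Redge-triangleCombination G complete x x∈R)
  where
  spans : TriangleCombination x → InSpan ((homogenize ∘ vertex) ∘ emb T) (homogenize x)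
  spans (l , l≥0 , Σl≡1 , x≡lv) = InSpan-support T (homogenize ∘ vertex) l (homogenize-lincomb l vertex Σl≡1 x≡lv) l≡0
    where
    l≡0 : ∀ i → i ∉ T → l i ≡ 0ℚ
    l≡0 i i∉T = decidable-stable (l i ≟ 0ℚ) λ li≢0 →
      i∉T (tight⇒∈T i (lincomb-tight a b l vertex l≥0 Σl≡1 x≡lv (λ i → valid (vertex i) (vertex-Redge G i)) ax≡b i li≢0))

-- A facet-defining face contains three affinely independent points, each a
-- combination of tight vertices only, while there are at most two tight vertices.
triangle-facet-has-zero : ∀ (G : Graph 3) → Complete G → ∀ a b → FacetDefining (Redge G) a b → ∃ λ j → a j ≡ 0ℚ
triangle-facet-has-zero G complete a b facet@(valid , _) with Fin.any? (λ j → a j ≟ 0ℚ)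
... | yes zero-coefficient = zero-coefficient
... | no  no-zero = ⊥-elim (too-few-tight (tightVertices≤2 a b (λ j aj≡0 → no-zero (j , aj≡0)) (valid halfPoint (halfPoint-Redge G))
                        (subst (_≤ b) (dot-chi-∅ a) (valid (vertex 1F) (vertex-Redge G 1F)))))
  where
  face : HasAffIndep (Face (Redge G) a b) 3
  face = full-facetDefining⇒face-dim (Redge G) a b (HasAffIndep-⊆ (Pstab⊆Redge G) (Pstab-full G)) facet
  too-few-tight : (∃ λ (T : Subset 5) → card T ℕ.≤ 2 × (∀ i → Tight a b i → i ∈ T)) → ⊥
  too-few-tight (T , card≤2 , tight⇒∈T) = ℕₚ.<-irrefl refl (ℕₚ.≤-trans 3≤card card≤2)
    where
    p = proj₁ face
    3≤card : 3 ℕ.≤ card T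
    3≤card = independent-in-span⇒≤ ((homogenize ∘ vertex) ∘ emb T) (homogenize ∘ p)
      (λ k → tightCombination-inSpan G complete a b valid T tight⇒∈T (p k)
               (proj₁ (proj₁ (proj₂ face) k)) (proj₂ (proj₁ (proj₂ face) k)))
      (affIndep⇒independent p (proj₂ (proj₂ face)))

-- Condition (A)

complete? : ∀ {n} (G : Graph n) → Dec (Complete G)
complete? G = Fin.all? λ u → Fin.all? λ v → ¬? (u Fin.≟ v) →-dec (adj G u v Bool.≟ true)

isK3? : ∀ {n} (G : Graph n) → Dec (IsK3 G)
isK3? {n} G = (n ℕ.≟ 3) ×-dec complete? G

RB⇒Pstab : ∀ {n} (G : Graph n) → ¬ IsK3 G → ∀ x → RB G x → Pstab G x
RB⇒Pstab G ¬K3 x (inj₁ (K3 , _))    = ⊥-elim (¬K3 K3)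
RB⇒Pstab G ¬K3 x (inj₂ (_ , x∈P))   = x∈P

RB⇒Redge : ∀ {n} (G : Graph n) → IsK3 G → ∀ x → RB G x → Redge G x
RB⇒Redge G K3 x (inj₁ (_ , x∈R))    = x∈R
RB⇒Redge G K3 x (inj₂ (¬K3 , _))    = ⊥-elim (¬K3 K3)

Pstab⊆RB : ∀ {n} (G : Graph n) x → Pstab G x → RB G x
Pstab⊆RB G x x∈P with isK3? G
... | yes K3 = inj₁ (K3 , Pstab⊆Redge G x x∈P)
... | no ¬K3 = inj₂ (¬K3 , x∈P)

FacetDefining-≐ : ∀ {n} {P Q : Poly n} a b → (∀ x → P x → Q x) → (∀ x → Q x → P x) →
  FacetDefining P a b → FacetDefining Q a b
FacetDefining-≐ {P = P} {Q} a b P⊆Q Q⊆P (valid , d , hasP , ¬hasP , hasF , ¬hasF) =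
  (λ x → valid x ∘ Q⊆P x) , d , HasAffIndep-⊆ P⊆Q hasP , ¬hasP ∘ HasAffIndep-⊆ Q⊆P ,
  HasAffIndep-⊆ {P = Face P a b} (λ x (x∈P , ax≡b) → P⊆Q x x∈P , ax≡b) hasF ,
  ¬hasF ∘ HasAffIndep-⊆ {P = Face Q a b} (λ x (x∈Q , ax≡b) → Q⊆P x x∈Q , ax≡b)

card≤ : ∀ {n} (U : Subset n) → card U ℕ.≤ n
card≤ []            = z≤n
card≤ (inside ∷ U)  = s≤s (card≤ U)
card≤ (outside ∷ U) = ℕₚ.m≤n⇒m≤1+n (card≤ U)

∉⇒card< : ∀ {n} (U : Subset n) {j} → j ∉ U → card U ℕ.< n
∉⇒card< (inside ∷ U)  {zero}  j∉U = ⊥-elim (j∉U here)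
∉⇒card< (outside ∷ U) {zero}  j∉U = s≤s (card≤ U)
∉⇒card< (inside ∷ U)  {suc j} j∉U = s≤s (∉⇒card< U (j∉U ∘ there))
∉⇒card< (outside ∷ U) {suc j} j∉U = ℕₚ.m≤n⇒m≤1+n (∉⇒card< U (j∉U ∘ there))

Redge-pullback : ∀ {m n} (G : Graph m) (H : Graph n) (f : Fin m → Fin n) →
  (∀ u v → adj G u v ≡ adj H (f u) (f v)) → ∀ x → Redge H x → Redge G (x ∘ f)
Redge-pullback G H f adj≡ x (bounds , edge) = bounds ∘ f , λ u v uv → edge (f u) (f v) (trans (sym (adj≡ u v)) uv)

Complete-pullback : ∀ {m n} (G : Graph m) (H : Graph n) (f : Fin m → Fin n) → (∀ {u v} → f u ≡ f v → u ≡ v) →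
  (∀ u v → adj G u v ≡ adj H (f u) (f v)) → Complete H → Complete G
Complete-pullback G H f f-injective adj≡ complete u v u≢v = trans (adj≡ u v) (complete (f u) (f v) (u≢v ∘ f-injective))

Redge-sum≤1 : ∀ {m} → m ℕ.≤ 2 → (H : Graph m) → Complete H → ∀ y → Redge H y → sumFin y ≤ 1ℚ
Redge-sum≤1 {0} _ H complete y _            = 0≤1
Redge-sum≤1 {1} _ H complete y (bounds , _) = subst (_≤ 1ℚ) (sym (+-identityʳ (y 0F))) (proj₂ (bounds 0F))
Redge-sum≤1 {2} _ H complete y (_ , edge)   =
  subst (_≤ 1ℚ) (cong (y 0F +_) (sym (+-identityʳ (y 1F)))) (edge 0F 1F (complete 0F 1F λ ()))
Redge-sum≤1 {suc (suc (suc m))} (s≤s (s≤s ()))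

Redge⊆Pstab-small : ∀ {m} → m ℕ.≤ 2 → (H : Graph m) → Complete H → ∀ y → Redge H y → Pstab H y
Redge⊆Pstab-small m≤2 H complete y y∈R =
  simplex⊆Pstab H y (proj₁ ∘ proj₁ y∈R) (Redge-sum≤1 m≤2 H complete y y∈R)

condA : CondA RB
condA G a b facet with isK3? G
... | no ¬K3 = facetDefining-restrict G (Pstab G) a b (λ _ → id) (Pstab-restrict G (supp a))
  (FacetDefining-≐ a b (RB⇒Pstab G ¬K3) (λ x x∈P → inj₂ (¬K3 , x∈P)) facet)
... | yes K3@(refl , complete) = facetDefining-restrict G (Redge G) a b (Pstab⊆Redge G) Redge→PU facetᴿ
  where
  facetᴿ : FacetDefining (Redge G) a b
  facetᴿ = FacetDefining-≐ a b (RB⇒Redge G K3) (λ x x∈R → inj₁ (K3 , x∈R)) facet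
  supp≤2 : card (supp a) ℕ.≤ 2
  supp≤2 with triangle-facet-has-zero G complete a b facetᴿ
  ... | j , aj≡0 = ℕₚ.≤-pred (∉⇒card< (supp a) (λ j∈supp → ∈supp⇒≢0 a j∈supp aj≡0))
  Redge→PU : ∀ x → Redge G x → Pstab (induced G (supp a)) (x ∘ emb (supp a))
  Redge→PU x x∈R = Redge⊆Pstab-small supp≤2 (induced G (supp a))
    (Complete-pullback (induced G (supp a)) G (emb (supp a)) (emb-injective (supp a)) (λ _ _ → refl) complete)
    (x ∘ emb (supp a)) (Redge-pullback (induced G (supp a)) G (emb (supp a)) (λ _ _ → refl) x x∈R)

-- Violation of condition (B)

triangle+isolated : Graph 4
triangle+isolated = record { adj = adj′ ; adj-sym = adj′-sym ; adj-irr = adj′-irr }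
  where
  adj′ : Fin 4 → Fin 4 → Bool
  adj′ 3F _  = false
  adj′ _  3F = false
  adj′ u  v  = not (does (u Fin.≟ v))
  adj′-sym : ∀ u v → adj′ u v ≡ adj′ v u
  adj′-sym = toWitness {a? = Fin.all? λ u → Fin.all? λ v → adj′ u v Bool.≟ adj′ v u} tt
  adj′-irr : ∀ v → adj′ v v ≡ false
  adj′-irr = toWitness {a? = Fin.all? λ v → adj′ v v Bool.≟ false} tt

triangleInequality : Point 4
triangleInequality 3F = 0ℚ
triangleInequality _  = 1ℚ

triangle+isolated-¬K3 : ¬ IsK3 triangle+isolated
triangle+isolated-¬K3 (() , _)

triangle-Is01-≤1 : ∀ {x y z} → Is01 x → Is01 y → Is01 z → x + y ≤ 1ℚ → x + z ≤ 1ℚ → y + z ≤ 1ℚ → x + y + z ≤ 1ℚ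
triangle-Is01-≤1 (inj₂ refl) (inj₂ refl) _           xy _  _  = ⊥-elim (¬1+1≤1 xy)
triangle-Is01-≤1 (inj₂ refl) _           (inj₂ refl) _  xz _  = ⊥-elim (¬1+1≤1 xz)
triangle-Is01-≤1 _           (inj₂ refl) (inj₂ refl) _  _  yz = ⊥-elim (¬1+1≤1 yz)
triangle-Is01-≤1 (inj₁ refl) (inj₁ refl) (inj₁ refl) _  _  _  = ≤ᵇ⇒≤ tt
triangle-Is01-≤1 (inj₂ refl) (inj₁ refl) (inj₁ refl) _  _  _  = ≤ᵇ⇒≤ tt
triangle-Is01-≤1 (inj₁ refl) (inj₂ refl) (inj₁ refl) _  _  _  = ≤ᵇ⇒≤ tt
triangle-Is01-≤1 (inj₁ refl) (inj₁ refl) (inj₂ refl) _  _  _  = ≤ᵇ⇒≤ tt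

triangleInequality-valid : Valid (Pstab triangle+isolated) triangleInequality 1ℚ
triangleInequality-valid = Conv-valid {S = StablePoint G} triangleInequality 1ℚ λ p p∈S →
  subst (_≤ 1ℚ) (sym (dot≡ p))
    (triangle-Is01-≤1 (StablePoint-Is01 G p∈S 0F) (StablePoint-Is01 G p∈S 1F) (StablePoint-Is01 G p∈S 2F)
      (StablePoint-edge G p∈S 0F 1F refl) (StablePoint-edge G p∈S 0F 2F refl) (StablePoint-edge G p∈S 1F 2F refl))
  where
  G = triangle+isolated
  dot≡ : ∀ p → dot triangleInequality p ≡ p 0F + p 1F + p 2F
  dot≡ p = solve 4 (λ a b c d → con 1ℚ :* a :+ (con 1ℚ :* b :+ (con 1ℚ :* c :+ (con 0ℚ :* d :+ con 0ℚ))) := a :+ b :+ c)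
    refl (p 0F) (p 1F) (p 2F) (p 3F)

facePoint : Fin 4 → Point 4
facePoint 3F = chi (inside ∷ outside ∷ outside ∷ inside ∷ [])
facePoint i  = chi ⁅ i ⁆

facePoint-stable : ∀ i → StablePoint triangle+isolated (facePoint i)
facePoint-stable 0F = unitPoint-stable triangle+isolated 1F
facePoint-stable 1F = unitPoint-stable triangle+isolated 2F
facePoint-stable 2F = unitPoint-stable triangle+isolated 3F
facePoint-stable 3F = _ , stable , λ _ → refl
  where
  stable : IsStable triangle+isolated (inside ∷ outside ∷ outside ∷ inside ∷ [])
  stable _ _ here                         here                         = refl
  stable _ _ here                         (there (there (there here))) = refl
  stable _ _ (there (there (there here))) here                         = refl
  stable _ _ (there (there (there here))) (there (there (there here))) = refl

facePoint-affIndep : AffIndep facePoint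
facePoint-affIndep μ Σμ≡0 μp≡0 = μ≡0
  where
  μ₃≡0 : μ 3F ≡ 0ℚ
  μ₃≡0 = trans (solve 4 (λ a b c d → d := a :* con 0ℚ :+ (b :* con 0ℚ :+ (c :* con 0ℚ :+ (d :* con 1ℚ :+ con 0ℚ))))
                  refl (μ 0F) (μ 1F) (μ 2F) (μ 3F)) (μp≡0 3F)
  μ≡0 : ∀ i → μ i ≡ 0ℚ
  μ≡0 0F = begin
    μ 0F                                    ≡⟨ solve 4 (λ a b c d → a := (a :* con 1ℚ :+ (b :* con 0ℚ :+ (c :* con 0ℚ :+ (d :* con 1ℚ :+ con 0ℚ)))) :- d)
                                                 refl (μ 0F) (μ 1F) (μ 2F) (μ 3F) ⟩
    lincomb μ facePoint 0F - μ 3F           ≡⟨ cong₂ _-_ (μp≡0 0F) μ₃≡0 ⟩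
    0ℚ - 0ℚ                                 ≡⟨ +-inverseʳ 0ℚ ⟩
    0ℚ                                      ∎
  μ≡0 1F = trans (solve 4 (λ a b c d → b := a :* con 0ℚ :+ (b :* con 1ℚ :+ (c :* con 0ℚ :+ (d :* con 0ℚ :+ con 0ℚ))))
                   refl (μ 0F) (μ 1F) (μ 2F) (μ 3F)) (μp≡0 1F)
  μ≡0 2F = trans (solve 4 (λ a b c d → c := a :* con 0ℚ :+ (b :* con 0ℚ :+ (c :* con 1ℚ :+ (d :* con 0ℚ :+ con 0ℚ))))
                   refl (μ 0F) (μ 1F) (μ 2F) (μ 3F)) (μp≡0 2F)
  μ≡0 3F = μ₃≡0

triangleInequality-facet : FacetDefining (Pstab triangle+isolated) triangleInequality 1ℚ
triangleInequality-facet = facetDefining-intro (Pstab G) triangleInequality 1ℚ (Pstab-full G)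
  triangleInequality-valid (0F , 1≢0)
  (facePoint , (λ i → Conv-single {S = StablePoint G} (facePoint-stable i) , on-face i) , facePoint-affIndep)
  where
  G = triangle+isolated
  on-face : ∀ i → dot triangleInequality (facePoint i) ≡ 1ℚ
  on-face 0F = refl
  on-face 1F = refl
  on-face 2F = refl
  on-face 3F = refl

-- The support of the inequality induces K₃, whose edge relaxation contains (½,½,½).
¬condB : ¬ CondB RB
¬condB condB = ≤⇒≤ᵇ (condB G triangleInequality 1ℚ facetᴿᴮ halfPoint (inj₁ (K3 , halfPoint-Redge H)))
  where
  G = triangle+isolated
  H = induced G (supp triangleInequality)
  facetᴿᴮ : FacetDefining (RB G) triangleInequality 1ℚ
  facetᴿᴮ = FacetDefining-≐ triangleInequality 1ℚ (Pstab⊆RB G) (RB⇒Pstab G triangle+isolated-¬K3) triangleInequality-facet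
  K3 : IsK3 H
  K3 = refl , toWitness {a? = complete? H} tt

-- Persistency

PersistentFor : ∀ {n} → Poly n → Point n → Point n → Set
PersistentFor {n} P c x = Σ (Point n) λ y → P y × (∀ i → Is01 (y i)) ×
  (∀ y′ → P y′ → (∀ i → Is01 (y′ i)) → dot c y′ ≤ dot c y) × (∀ i → Is01 (x i) → y i ≡ x i)

HasPersistency-≐ : ∀ {n} {P Q : Poly n} → (∀ x → P x → Q x) → (∀ x → Q x → P x) → HasPersistency P → HasPersistency Q
HasPersistency-≐ P⊆Q Q⊆P (cube , persistent) = (λ x → cube x ∘ Q⊆P x) , λ c x x∈Q x-max →
  let y , y∈P , y01 , y-max , y≡x = persistent c x (Q⊆P x x∈Q) (λ x′ → x-max x′ ∘ P⊆Q x′)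
  in  y , P⊆Q y y∈P , y01 , (λ y′ → y-max y′ ∘ Q⊆P y′) , y≡x

sumFin≡1⇒∃≢0 : ∀ {k} (μ : Fin k → ℚ) → sumFin μ ≡ 1ℚ → ∃ λ i → μ i ≢ 0ℚ
sumFin≡1⇒∃≢0 {k} μ Σμ≡1 with nonzero-or-zero μ
... | inj₁ nonzero = nonzero
... | inj₂ μ≡0 = ⊥-elim (1≢0 (trans (sym Σμ≡1) (trans (sumFin-cong μ≡0) (sumFin-zero k))))

lincomb-persistent : ∀ {n k} (P : Poly n) (c x : Point n) (μ : Fin k → ℚ) (p : Fin k → Point n) →
  (∀ i → 0ℚ ≤ μ i) → sumFin μ ≡ 1ℚ → (∀ j → x j ≡ lincomb μ p j) → (∀ i → P (p i)) →
  (∀ i j → (0ℚ ≤ p i j) × (p i j ≤ 1ℚ)) → (∀ x′ → P x′ → dot c x′ ≤ dot c x) →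
  ∀ i → μ i ≢ 0ℚ → (dot c (p i) ≡ dot c x) × (∀ j → Is01 (x j) → p i j ≡ x j)
lincomb-persistent P c x μ p μ≥0 Σμ≡1 x≡μp p∈P p∈cube x-max i μi≢0 =
  lincomb-tight c (dot c x) μ p μ≥0 Σμ≡1 x≡μp (λ i → x-max (p i) (p∈P i)) refl i μi≢0 , agree
  where
  agree : ∀ j → Is01 (x j) → p i j ≡ x j
  agree j (inj₁ xj≡0) = trans (nonNeg-terms-sumFin≡0 μ (λ i → p i j) μ≥0 (λ i → proj₁ (p∈cube i j))
    (trans (sym (x≡μp j)) xj≡0) i μi≢0) (sym xj≡0)
  agree j (inj₂ xj≡1) = trans (convexCombination-≡max μ (λ i → p i j) 1ℚ μ≥0 Σμ≡1 (λ i → proj₂ (p∈cube i j))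
    (trans (sym (x≡μp j)) xj≡1) i μi≢0) (sym xj≡1)

Pstab-persistency : ∀ {n} (G : Graph n) → HasPersistency (Pstab G)
Pstab-persistency G = (λ x → proj₁ ∘ Pstab⊆Redge G x) , persistent
  where
  persistent : ∀ c x → Pstab G x → (∀ x′ → Pstab G x′ → dot c x′ ≤ dot c x) → PersistentFor (Pstab G) c x
  persistent c x (k , p , μ , p∈S , μ≥0 , Σμ≡1 , x≡μp) x-max with sumFin≡1⇒∃≢0 μ Σμ≡1
  ... | i , μi≢0 = p i , p∈P i , StablePoint-Is01 G (p∈S i) ,
    (λ y′ y′∈P _ → subst (dot c y′ ≤_) (sym (proj₁ summand)) (x-max y′ y′∈P)) , proj₂ summand
    where
    p∈P : ∀ i → Pstab G (p i)
    p∈P i = Conv-single {S = StablePoint G} (p∈S i)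
    summand = lincomb-persistent (Pstab G) c x μ p μ≥0 Σμ≡1 x≡μp p∈P
      (λ i j → Is01⇒bounds (StablePoint-Is01 G (p∈S i) j)) x-max i μi≢0

½≢0 : ½ ≢ 0ℚ
½≢0 ()

½≢1 : ½ ≢ 1ℚ
½≢1 ()

integralWeights≡0⇒≡½ : ∀ {x : Point 3} (l : Fin 5 → ℚ) → sumFin l ≡ 1ℚ → (∀ j → x j ≡ lincomb l vertex j) →
  (∀ i → l (suc i) ≡ 0ℚ) → ∀ j → x j ≡ ½
integralWeights≡0⇒≡½ {x} l Σl≡1 x≡lv l∘suc≡0 j = begin
  x j                                         ≡⟨ x≡lv j ⟩
  l 0F * ½ + lincomb (l ∘ suc) unitPoint j    ≡⟨ cong₂ (λ p q → p * ½ + q) l₀≡1 (trans (lincomb-unitPoint (l ∘ suc) j) (l∘suc≡0 (suc j))) ⟩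
  1ℚ * ½ + 0ℚ                                 ≡⟨ +-identityʳ (1ℚ * ½) ⟩
  1ℚ * ½                                      ≡⟨ *-identityˡ ½ ⟩
  ½                                           ∎
  where
  l₀≡1 : l 0F ≡ 1ℚ
  l₀≡1 = begin
    l 0F                       ≡⟨ +-identityʳ (l 0F) ⟨
    l 0F + 0ℚ                  ≡⟨ cong (l 0F +_) (trans (sumFin-cong l∘suc≡0) (sumFin-zero 4)) ⟨
    l 0F + sumFin (l ∘ suc)    ≡⟨ Σl≡1 ⟩
    1ℚ                         ∎

-- Either an integral vertex carries weight in the decomposition of x, or x = (½,½,½)
-- has no integral coordinate and the best integral vertex will do.
Redge-persistency : ∀ (G : Graph 3) → Complete G → HasPersistency (Redge G)
Redge-persistency G complete = (λ x → proj₁) ,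
  λ c x x∈R x-max → persistent c x x-max (Redge-triangleCombination G complete x x∈R)
  where
  vertex-cube : ∀ i j → (0ℚ ≤ vertex i j) × (vertex i j ≤ 1ℚ)
  vertex-cube i = proj₁ (vertex-Redge G i)
  unitPoint-Is01 : ∀ i j → Is01 (unitPoint i j)
  unitPoint-Is01 i = StablePoint-Is01 G (unitPoint-stable G i)
  persistent : ∀ c x → (∀ x′ → Redge G x′ → dot c x′ ≤ dot c x) → TriangleCombination x → PersistentFor (Redge G) c x
  persistent c x x-max (l , l≥0 , Σl≡1 , x≡lv) with nonzero-or-zero (l ∘ suc)
  ... | inj₁ (i , li≢0) = unitPoint i , vertex-Redge G (suc i) , unitPoint-Is01 i ,
    (λ y′ y′∈R _ → subst (dot c y′ ≤_) (sym (proj₁ summand)) (x-max y′ y′∈R)) , proj₂ summand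
    where
    summand = lincomb-persistent (Redge G) c x l vertex l≥0 Σl≡1 x≡lv (vertex-Redge G) vertex-cube x-max (suc i) li≢0
  ... | inj₂ l∘suc≡0 = best-integral (argmax (λ i → dot c (unitPoint i)))
    where
    x≡½ : ∀ j → x j ≡ ½
    x≡½ = integralWeights≡0⇒≡½ l Σl≡1 x≡lv l∘suc≡0
    best-integral : (∃ λ k → ∀ k′ → dot c (unitPoint k′) ≤ dot c (unitPoint k)) → PersistentFor (Redge G) c x
    best-integral (best , best-max) =
      unitPoint best , vertex-Redge G (suc best) , unitPoint-Is01 best , integral-max , no-integral
      where
      integral-max : ∀ y′ → Redge G y′ → (∀ i → Is01 (y′ i)) → dot c y′ ≤ dot c (unitPoint best)
      integral-max y′ y′∈R y′01 = is-vertex (Redge-integral G complete y′ y′∈R y′01)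
        where
        is-vertex : (∃ λ i → ∀ j → y′ j ≡ unitPoint i j) → dot c y′ ≤ dot c (unitPoint best)
        is-vertex (i , y′≡) = subst (_≤ dot c (unitPoint best)) (dot-cong c (sym ∘ y′≡)) (best-max i)
      no-integral : ∀ j → Is01 (x j) → unitPoint best j ≡ x j
      no-integral j (inj₁ xj≡0) = ⊥-elim (½≢0 (trans (sym (x≡½ j)) xj≡0))
      no-integral j (inj₂ xj≡1) = ⊥-elim (½≢1 (trans (sym (x≡½ j)) xj≡1))

RB-persistency : ∀ {n} (G : Graph n) → HasPersistency (RB G)
RB-persistency G with isK3? G
... | yes K3@(refl , complete) =
  HasPersistency-≐ (λ x x∈R → inj₁ (K3 , x∈R)) (RB⇒Redge G K3) (Redge-persistency G complete)
... | no ¬K3 =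
  HasPersistency-≐ (λ x x∈P → inj₂ (¬K3 , x∈P)) (RB⇒Pstab G ¬K3) (Pstab-persistency G)

-- Condition (C)

Redge⊆RB-small : ∀ {n} (G : Graph n) → Complete G → n ℕ.≤ 3 → ∀ x → Redge G x → RB G x
Redge⊆RB-small {n} G complete n≤3 x x∈R with n ℕ.≟ 3
... | yes refl = inj₁ ((refl , complete) , x∈R)
... | no  n≢3  = Pstab⊆RB G x (Redge⊆Pstab-small (ℕₚ.≤-pred (ℕₚ.≤∧≢⇒< n≤3 n≢3)) G complete x x∈R)

module OneSum {n₁ m₂} (G₁ : Graph n₁) (G₂ : Graph (suc m₂)) (v₁ : Fin n₁) (v₂ : Fin (suc m₂)) where

  H : Graph (n₁ ℕ.+ m₂)
  H = oneSum G₁ G₂ v₁ v₂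

  glue : Fin (n₁ ℕ.+ suc m₂) → Fin (n₁ ℕ.+ m₂)
  glue k with splitAt n₁ k
  ... | inj₁ u = u ↑ˡ m₂
  ... | inj₂ t with v₂ Fin.≟ t
  ...   | yes _    = v₁ ↑ˡ m₂
  ...   | no v₂≢t = n₁ ↑ʳ punchOut v₂≢t

  left : Fin n₁ → Fin (n₁ ℕ.+ m₂)
  left u = glue (u ↑ˡ suc m₂)

  right : Fin (suc m₂) → Fin (n₁ ℕ.+ m₂)
  right t = glue (n₁ ↑ʳ t)

  left≡ : ∀ u → left u ≡ u ↑ˡ m₂
  left≡ u rewrite Fin.splitAt-↑ˡ n₁ u (suc m₂) = refl

  right-v₂ : right v₂ ≡ v₁ ↑ˡ m₂
  right-v₂ rewrite Fin.splitAt-↑ʳ n₁ (suc m₂) v₂ with v₂ Fin.≟ v₂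
  ... | yes _ = refl
  ... | no v₂≢v₂ = ⊥-elim (v₂≢v₂ refl)

  right≢v₂ : ∀ t (v₂≢t : v₂ ≢ t) → right t ≡ n₁ ↑ʳ punchOut v₂≢t
  right≢v₂ t v₂≢t rewrite Fin.splitAt-↑ʳ n₁ (suc m₂) t with v₂ Fin.≟ t
  ... | yes v₂≡t = ⊥-elim (v₂≢t v₂≡t)
  ... | no _     = cong (n₁ ↑ʳ_) (Fin.punchOut-cong v₂ refl)

  right-punchIn : ∀ s → right (punchIn v₂ s) ≡ n₁ ↑ʳ s
  right-punchIn s = trans (right≢v₂ (punchIn v₂ s) (Fin.punchInᵢ≢i v₂ s ∘ sym))
    (cong (n₁ ↑ʳ_) (trans (Fin.punchOut-cong v₂ refl) (Fin.punchOut-punchIn v₂)))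

  toG₁-↑ˡ : ∀ u → toG₁ {n₁} {m₂} (u ↑ˡ m₂) ≡ just u
  toG₁-↑ˡ u rewrite Fin.splitAt-↑ˡ n₁ u m₂ = refl

  toG₁-↑ʳ : ∀ s → toG₁ {n₁} {m₂} (n₁ ↑ʳ s) ≡ nothing
  toG₁-↑ʳ s rewrite Fin.splitAt-↑ʳ n₁ m₂ s = refl

  toG₂-↑ʳ : ∀ s → toG₂ v₁ v₂ (n₁ ↑ʳ s) ≡ just (punchIn v₂ s)
  toG₂-↑ʳ s rewrite Fin.splitAt-↑ʳ n₁ m₂ s = refl

  toG₂-v₁ : toG₂ v₁ v₂ (v₁ ↑ˡ m₂) ≡ just v₂
  toG₂-v₁ rewrite Fin.splitAt-↑ˡ n₁ v₁ m₂ with v₁ Fin.≟ v₁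
  ... | yes _    = refl
  ... | no v₁≢v₁ = ⊥-elim (v₁≢v₁ refl)

  toG₂-↑ˡ : ∀ u → u ≢ v₁ → toG₂ v₁ v₂ (u ↑ˡ m₂) ≡ nothing
  toG₂-↑ˡ u u≢v₁ rewrite Fin.splitAt-↑ˡ n₁ u m₂ with u Fin.≟ v₁
  ... | yes u≡v₁ = ⊥-elim (u≢v₁ u≡v₁)
  ... | no _     = refl

  toG₂-right : ∀ t → toG₂ v₁ v₂ (right t) ≡ just t
  toG₂-right t with v₂ Fin.≟ t
  ... | yes refl  = trans (cong (toG₂ v₁ v₂) right-v₂) toG₂-v₁
  ... | no  v₂≢t = trans (cong (toG₂ v₁ v₂) (right≢v₂ t v₂≢t)) (trans (toG₂-↑ʳ _) (cong just (Fin.punchIn-punchOut v₂≢t)))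

  toG₁-right : ∀ t → v₂ ≢ t → toG₁ {n₁} {m₂} (right t) ≡ nothing
  toG₁-right t v₂≢t = trans (cong toG₁ (right≢v₂ t v₂≢t)) (toG₁-↑ʳ _)

  adjM-nothingʳ : ∀ {n} (G : Graph n) x → adjM G x nothing ≡ false
  adjM-nothingʳ G (just _) = refl
  adjM-nothingʳ G nothing  = refl

  adj-left : ∀ u u′ → adj G₁ u u′ ≡ adj H (left u) (left u′)
  adj-left u u′ rewrite left≡ u | left≡ u′ | toG₁-↑ˡ u | toG₁-↑ˡ u′ =
    sym (trans (cong (adj G₁ u u′ ∨_) G₂-part) (∨-identityʳ _))
    where
    G₂-part : adjM G₂ (toG₂ v₁ v₂ (u ↑ˡ m₂)) (toG₂ v₁ v₂ (u′ ↑ˡ m₂)) ≡ false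
    G₂-part with u Fin.≟ v₁ | u′ Fin.≟ v₁
    ... | yes refl | yes refl = trans (cong₂ (adjM G₂) toG₂-v₁ toG₂-v₁) (adj-irr G₂ v₂)
    ... | no u≢v₁  | _        = cong (λ m → adjM G₂ m (toG₂ v₁ v₂ (u′ ↑ˡ m₂))) (toG₂-↑ˡ u u≢v₁)
    ... | yes _    | no u′≢v₁ =
      trans (cong (adjM G₂ (toG₂ v₁ v₂ (u ↑ˡ m₂))) (toG₂-↑ˡ u′ u′≢v₁)) (adjM-nothingʳ G₂ (toG₂ v₁ v₂ (u ↑ˡ m₂)))

  adj-right : ∀ t t′ → adj G₂ t t′ ≡ adj H (right t) (right t′)
  adj-right t t′ rewrite toG₂-right t | toG₂-right t′ = sym G₁-part
    where
    G₁-part : (adjM G₁ (toG₁ {n₁} {m₂} (right t)) (toG₁ {n₁} {m₂} (right t′)) ∨ adj G₂ t t′) ≡ adj G₂ t t′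
    G₁-part with v₂ Fin.≟ t | v₂ Fin.≟ t′
    ... | no v₂≢t | _ rewrite toG₁-right t v₂≢t = refl
    ... | yes refl | no v₂≢t′ rewrite toG₁-right t′ v₂≢t′ | adjM-nothingʳ G₁ (toG₁ {n₁} {m₂} (right v₂)) = refl
    ... | yes refl | yes refl rewrite right-v₂ | toG₁-↑ˡ v₁ | adj-irr G₁ v₁ = refl

  right-injective : ∀ {t t′} → right t ≡ right t′ → t ≡ t′
  right-injective {t} {t′} eq = Maybe.just-injective (trans (sym (toG₂-right t)) (trans (cong (toG₂ v₁ v₂) eq) (toG₂-right t′)))

  left-injective : ∀ {u u′} → left u ≡ left u′ → u ≡ u′
  left-injective {u} {u′} eq = Fin.↑ˡ-injective m₂ u u′ (trans (sym (left≡ u)) (trans eq (left≡ u′)))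

-- Definitionally the polytope whose convex hull oneSumPoly projects.
GluedPoly : ∀ {n₁ m₂} → Poly n₁ → Poly (suc m₂) → Fin n₁ → Fin (suc m₂) → Poly (n₁ ℕ.+ suc m₂)
GluedPoly {n₁} {m₂} P Q v₁ v₂ w =
  P (λ u → w (u ↑ˡ suc m₂)) × Q (λ t → w (n₁ ↑ʳ t)) × (w (v₁ ↑ˡ suc m₂) ≡ w (n₁ ↑ʳ v₂))

-- The agreement condition of oneSumPoly is phrased with a projection local to its
-- definition, so its type is read off oneSumPoly by unification.
OneSumAgreement : ∀ {n₁ m₂} (P : Poly n₁) (Q : Poly (suc m₂)) v₁ v₂ →
  Point (n₁ ℕ.+ m₂) → Point (n₁ ℕ.+ suc m₂) → Fin (n₁ ℕ.+ m₂) → Set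
OneSumAgreement P Q v₁ v₂ z = agreementOf (oneSumPoly P Q v₁ v₂ z) refl
  where
  agreementOf : ∀ {W K : Set} {C : W → Set} {E : W → K → Set} (X : Set) →
    X ≡ Σ W (λ w → C w × ((k : K) → E w k)) → W → K → Set
  agreementOf {E = E} _ _ = E

oneSumPoly-intro : ∀ {n₁ m₂} (P : Poly n₁) (Q : Poly (suc m₂)) v₁ v₂ z w → Conv (GluedPoly P Q v₁ v₂) w →
  (∀ u → z (u ↑ˡ m₂) ≡ w (u ↑ˡ suc m₂)) → (∀ s → z (n₁ ↑ʳ s) ≡ w (n₁ ↑ʳ punchIn v₂ s)) →
  oneSumPoly P Q v₁ v₂ z
oneSumPoly-intro {n₁} P Q v₁ v₂ z w w∈ z≡left z≡right = w , w∈ , agreement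
  where
  agreement : ∀ k → OneSumAgreement P Q v₁ v₂ z w k
  agreement k with splitAt n₁ k in eq
  ... | inj₁ u = trans (cong z (sym (Fin.splitAt⁻¹-↑ˡ eq))) (z≡left u)
  ... | inj₂ s = trans (cong z (sym (Fin.splitAt⁻¹-↑ʳ eq))) (z≡right s)

1+m≤n+m : ∀ {n} m → Fin n → suc m ℕ.≤ n ℕ.+ m
1+m≤n+m {suc n} m _ = s≤s (ℕₚ.m≤n+m m n)

-- In the K₃ case both parts are complete graphs on at most three vertices.
condC : CondC RB
condC {n₁} {m₂} G₁ G₂ v₁ v₂ z z∈RH = oneSumPoly-intro (RB G₁) (RB G₂) v₁ v₂ z (z ∘ glue) (glued z∈RH)
  (λ u → cong z (sym (left≡ u))) (λ s → cong z (sym (right-punchIn s)))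
  where
  open OneSum G₁ G₂ v₁ v₂
  glued : RB H z → Conv (GluedPoly (RB G₁) (RB G₂) v₁ v₂) (z ∘ glue)
  glued (inj₂ (_ , z∈P)) = Conv-∘ {S = StablePoint H} {S′ = GluedPoly (RB G₁) (RB G₂) v₁ v₂} glue
    (λ p p∈S → Pstab⊆RB G₁ (p ∘ left) (Conv-single {S = StablePoint G₁} (StablePoint-pullback G₁ H left adj-left p p∈S)) ,
               Pstab⊆RB G₂ (p ∘ right) (Conv-single {S = StablePoint G₂} (StablePoint-pullback G₂ H right adj-right p p∈S)) ,
               cong p (trans (left≡ v₁) (sym right-v₂)))
    z z∈P
  glued (inj₁ ((n≡3 , complete) , z∈R)) = Conv-single {S = GluedPoly (RB G₁) (RB G₂) v₁ v₂}
    (Redge⊆RB-small G₁ (Complete-pullback G₁ H left left-injective adj-left complete)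
       (subst (n₁ ℕ.≤_) n≡3 (ℕₚ.m≤m+n n₁ m₂)) (z ∘ left) (Redge-pullback G₁ H left adj-left z z∈R) ,
     Redge⊆RB-small G₂ (Complete-pullback G₂ H right right-injective adj-right complete)
       (subst (suc m₂ ℕ.≤_) n≡3 (1+m≤n+m m₂ v₁)) (z ∘ right) (Redge-pullback G₂ H right adj-right z z∈R) ,
     cong z (trans (left≡ v₁) (sym right-v₂)))

proposition5 : CondA RB × CondC RB × ¬ CondB RB ×
    (∀ {n : ℕ} (G : Graph n) → HasPersistency (RB G))
proposition5 = condA , condC , ¬condB , RB-persistency
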